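{- Let $r\ge 1$ be an integer. For every integer $n\ge 2$ and for each $\mathrm{O}\in\{\mathrm{Abs},\mathrm{Clr}\}$, $$P^{\mathrm{O}}_{G_{r,n}}(q,1,-1)=(q^r-1)\,P^{\mathrm{O}}_{G_{r,n-1}}(q,1,-1),$$ and $P^{\mathrm{Abs}}_{G_{r,n}}(q,1,-1)=P^{\mathrm{Clr}}_{G_{r,n}}(q,1,-1)$. Consequently, for every $n\ge 1$, $$P^{\mathrm{Abs}}_{G_{r,n}}(q,1,-1)=P^{\mathrm{Clr}}_{G_{r,n}}(q,1,-1)=-\frac{(q^r-1)^n}{q-1}.$$
   Context: For positive integers $r,n$, $G_{r,n}=\mathbb{Z}_r\wr S_n$ is the set of pairs $\sigma=(z,\tau)$ with $z=(z_1,\dots,z_n)\in\{0,\dots,r-1\}^n$ and $\tau\in S_n$, with product $(z,\tau)(z',\tau')=((z_1+z'_{\tau(1)},\dots,z_n+z'_{\tau(n)}),\tau\circ\tau')$ (addition mod $r$). Write $z_i(\sigma)=z_i$ and $|\sigma|=\tau$. Statistics: $\mathrm{exc}(|\sigma|)=\#\{i\in[n]:\tau(i)>i\}$; $\mathrm{csum}(\sigma)=\sum_{i=1}^n z_i(\sigma)$ (sum of the integers $z_i\in\{0,\dots,r-1\}$); $\mathrm{exc}_A(\sigma)=\#\{i\in[n-1]: z_i(\sigma)=0 \text{ and } \tau(i)>i\}$; $\mathrm{cyc}(\sigma)$ = number of cycles of $\tau$; $\mathrm{fix}(\sigma)=\#\{i\in[n]:\tau(i)=i\}$ (absolute fixed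 points). Define $\mathrm{exc}^{\mathrm{Abs}}(\sigma)=\mathrm{exc}(|\sigma|)+\mathrm{csum}(\sigma)$ and $\mathrm{exc}^{\mathrm{Clr}}(\sigma)=r\cdot\mathrm{exc}_A(\sigma)+\mathrm{csum}(\sigma)$. For $\mathrm{O}\in\{\mathrm{Abs},\mathrm{Clr}\}$ and a subset $X\subseteq G_{r,n}$, $P^{\mathrm{O}}_{X}(q,t,s)=\sum_{\sigma\in X}q^{\mathrm{exc}^{\mathrm{O}}(\sigma)}t^{\mathrm{fix}(\sigma)}s^{\mathrm{cyc}(\sigma)}$. -}

module Defs where

open import Data.Nat as ℕ using (ℕ; zero; suc; _<_; _∸_)
open import Data.Nat.ListAction using (sum)
open import Data.Integer as ℤ using (ℤ; +_; -_)
open import Data.Fin using (Fin; toℕ)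
open import Data.Fin.Properties using (all?) renaming (_≟_ to _≟ᶠ_)
open import Data.Vec as Vec using (Vec; lookup)
open import Data.List as List using (List; []; _∷_; allFin; filter; length; concatMap; map; foldr; replicate)
open import Data.Product using (_×_; _,_; proj₁; proj₂)
open import Relation.Nullary.Decidable using (_→-dec_; _×-dec_)
open import Relation.Binary.PropositionalEquality using (_≡_)

-- Univariate polynomials over ℤ in the variable q, as coefficient lists
-- (constant term first).  Equality is coefficientwise (trailing zeros
-- are irrelevant).

Poly : Set
Poly = List ℤ

coeff : Poly → ℕ → ℤ
coeff []       _       = + 0
coeff (a ∷ p)  zero    = a
coeff (a ∷ p)  (suc k) = coeff p k

infix 4 _≈P_
_≈P_ : Poly → Poly → Set
p ≈P p' = ∀ k → coeff p k ≡ coeff p' k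

infixl 6 _+P_
_+P_ : Poly → Poly → Poly
[]      +P p'       = p'
(a ∷ p) +P []       = a ∷ p
(a ∷ p) +P (b ∷ p') = (a ℤ.+ b) ∷ (p +P p')

scaleP : ℤ → Poly → Poly
scaleP c = map (c ℤ.*_)

negP : Poly → Poly
negP = scaleP (- + 1)

infixl 7 _*P_
_*P_ : Poly → Poly → Poly
[]      *P p' = []
(a ∷ p) *P p' = scaleP a p' +P (+ 0 ∷ (p *P p'))

constP : ℤ → Poly
constP c = c ∷ []

monoP : ℤ → ℕ → Poly
monoP c e = replicate e (+ 0) List.++ (c ∷ [])

qP : Poly
qP = monoP (+ 1) 1

infixr 8 _^P_
_^P_ : Poly → ℕ → Poly
p ^P zero  = constP (+ 1)
p ^P suc n = p *P (p ^P n)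

sumP : List Poly → Poly
sumP = foldr _+P_ []

allVecs : ∀ {A : Set} → List A → (n : ℕ) → List (Vec A n)
allVecs xs zero    = Vec.[] ∷ []
allVecs xs (suc n) = concatMap (λ x → map (x Vec.∷_) (allVecs xs n)) xs

IsPerm : ∀ {n} → Vec (Fin n) n → Set
IsPerm {n} τ = ∀ i j → lookup τ i ≡ lookup τ j → i ≡ j

isPerm? : ∀ {n} (τ : Vec (Fin n) n) → Relation.Nullary.Decidable.Dec (IsPerm τ)
isPerm? τ = all? λ i → all? λ j → (lookup τ i ≟ᶠ lookup τ j) →-dec (i ≟ᶠ j)
  where import Relation.Nullary.Decidable

allPerms : (n : ℕ) → List (Vec (Fin n) n)
allPerms n = filter isPerm? (allVecs (allFin n) n)

-- Elements of G_{r,n} = ℤ_r ≀ S_n : pairs (z , τ), z_i ∈ {0,…,r-1}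
G : ℕ → ℕ → Set
G r n = Vec (Fin r) n × Vec (Fin n) n

allG : (r n : ℕ) → List (G r n)
allG r n = concatMap (λ z → map (z ,_) (allPerms n)) (allVecs (allFin r) n)

countFin : ∀ n {P : Fin n → Set} → ((i : Fin n) → Relation.Nullary.Decidable.Dec (P i)) → ℕ
countFin n P? = length (filter P? (allFin n))
  where import Relation.Nullary.Decidable

module _ {r n : ℕ} (σ : G r n) where
  private
    z = proj₁ σ
    τ = proj₂ σ

  zᵢ : Fin n → ℕ
  zᵢ i = toℕ (lookup z i)

  τᵢ : Fin n → Fin n
  τᵢ i = lookup τ i

  exc : ℕ
  exc = countFin n (λ i → toℕ i ℕ.<? toℕ (τᵢ i))

  csum : ℕ
  csum = sum (map zᵢ (allFin n))

  -- exc_A(σ) = #{ i ∈ [n-1] : z_i = 0 and τ(i) > i }   (i ↦ toℕ i + 1)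
  excA : ℕ
  excA = countFin n (λ i → (suc (toℕ i) ℕ.≤? n ∸ 1)
                          ×-dec (zᵢ i ℕ.≟ 0)
                          ×-dec (toℕ i ℕ.<? toℕ (τᵢ i)))

  fix : ℕ
  fix = countFin n (λ i → τᵢ i ≟ᶠ i)

  iter : ℕ → Fin n → Fin n
  iter zero    i = i
  iter (suc k) i = τᵢ (iter k i)

  -- cyc(σ) = number of cycles of τ, counted by their least elements:
  -- i is the least element of its cycle iff i ≤ τ^k(i) for all k < n
  -- (every cycle has length ≤ n, so this covers the whole cycle).
  cyc : ℕ
  cyc = countFin n (λ i → all? {P = λ (k : Fin n) → toℕ i ℕ.≤ toℕ (iter (toℕ k) i)}
                                 (λ k → toℕ i ℕ.≤? toℕ (iter (toℕ k) i)))

data Order : Set where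
  Abs Clr : Order

excO : Order → ∀ {r n} → G r n → ℕ
excO Abs σ = exc σ ℕ.+ csum σ
excO Clr {r} σ = r ℕ.* excA σ ℕ.+ csum σ

-- P^O_X(q,t,s) = Σ_{σ ∈ X} q^{exc^O σ} t^{fix σ} s^{cyc σ}, as a polynomial
-- in q, for given integer values of t and s.
P : Order → ∀ {r n} → List (G r n) → (t s : ℤ) → Poly
P O X t s = sumP (map (λ σ → monoP ((t ℤ.^ fix σ) ℤ.* (s ℤ.^ cyc σ)) (excO O σ)) X)

PG : Order → (r n : ℕ) → Poly
PG O r n = P O (allG r n) (+ 1) (- + 1)

{-# OPTIONS --safe #-}
module Submission where

-- Summing over the colours first, each letter i of a coloured permutation (z , τ) contributes the
-- factor [r]_q = 1 + q + ⋯ + q^(r-1), times q when τ(i) > i: for Clr, colour 0 then contributes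
-- q^r and colour a > 0 contributes q^a.  Hence for both orders
--   P_{G_{r,n}}(q,1,-1) = P_{S_n}(q,1,-1) · [r]_q^n.
-- Inserting the letter n+1 into a permutation of [n] as a fixed point multiplies its weight by -1;
-- inserting it after j in its cycle keeps the cycles and adds an excedance iff τ(j) ≤ j. So
--   P_{S_{n+1}} = (n q - 1) P_{S_n} + (1 - q) θ P_{S_n},   θ = q d/dq,
-- which is solved by P_{S_n}(q,1,-1) = -(q - 1)^(n-1). Finally [r]_q (q - 1) = q^r - 1.

open import Defs
open import Data.Nat as ℕ using (ℕ; zero; suc; _≤_; _<_; _≤?_; _<?_; _∸_)
import Data.Nat.Properties as ℕₚ
open import Data.Nat.DivMod using (_%_; _/_; m%n<n; m≡m%n+[m/n]*n)
open import Data.Integer as ℤ using (ℤ; +_; -_)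
import Data.Integer.Properties as ℤₚ
open import Data.Fin as Fin using (Fin; toℕ; inject₁; fromℕ; fromℕ<)
import Data.Fin.Properties as Finₚ
open import Data.Fin.Properties using (_≟_; all?)
open import Data.Fin.Relation.Unary.Top using (view; ‵fromℕ; ‵inject₁; view-fromℕ; view-inject₁)
import Data.Fin.Permutation.Components as PC
open import Data.Vec as Vec using (Vec; lookup; tabulate)
import Data.Vec.Properties as Vecₚ
open import Data.List as List using (List; []; _∷_; _++_; map; allFin; filter; length; concatMap; cartesianProductWith)
open import Data.Nat.ListAction using (sum)
import Data.List.Properties as Listₚ
open import Data.List.Membership.Propositional using (_∈_)
open import Data.List.Membership.Propositional.Properties
  using (∈-filter⁺; ∈-filter⁻; ∈-cartesianProductWith⁺; ∈-cartesianProductWith⁻; ∈-allFin)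
open import Data.List.Membership.Propositional.Properties.WithK using (unique∧set⇒bag)
open import Data.List.Relation.Unary.Any using (here; there)
open import Data.List.Relation.Unary.All using ([])
open import Data.List.Relation.Unary.AllPairs using ([]; _∷_)
open import Data.List.Relation.Unary.Unique.Propositional using (Unique)
open import Data.List.Relation.Unary.Unique.Propositional.Properties using (cartesianProductWith⁺; filter⁺; allFin⁺)
open import Data.List.Relation.Binary.Permutation.Propositional using (_↭_; ↭⇒↭ₛ′)
import Data.List.Relation.Binary.Permutation.Propositional.Properties as ↭
import Data.List.Relation.Binary.Permutation.Setoid.Properties as ↭ₛ
open import Data.List.Relation.Binary.BagAndSetEquality using (∼bag⇒↭)
open import Data.Maybe using (Maybe; just; nothing)
open import Data.Product using (_×_; _,_; proj₁; proj₂; ∃; ∃₂)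
open import Data.Sum using (_⊎_; inj₁; inj₂)
open import Relation.Nullary using (Dec; yes; no; ¬_; contradiction)
open import Relation.Nullary.Decidable using (dec-true; dec-false; _×-dec_)
open import Relation.Binary.Bundles using (Setoid)
open import Relation.Binary.PropositionalEquality
import Relation.Binary.Reasoning.Setoid as SetoidReasoning
open import Function using (_∘_; _⇔_; mk⇔; Equivalence)
open import Function.Definitions using (Injective)
import Function.Properties.Equivalence as ⇔
open import Algebra.Bundles using (CommutativeRing)
open import Algebra.Structures using (IsCommutativeRing)
import Algebra.Properties.CommutativeSemigroup as CommSemigroupProperties
import Algebra.Properties.Semiring.Sum as SemiringSum
open import Tactic.RingSolver.Core.AlmostCommutativeRing using (fromCommutativeRing)
import Tactic.RingSolver.NonReflective as NonReflective

private
  module ℤ+ = CommSemigroupProperties ℤₚ.+-commutativeSemigroup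
  module ℤ* = CommSemigroupProperties ℤₚ.*-commutativeSemigroup

-- The polynomial ring ℤ[q]

-- _≈P_ is wrapped in a record so that both polynomials can be inferred from an equation.
infix 4 _≋_
record _≋_ (p p′ : Poly) : Set where
  constructor mk≋
  field coeff-≡ : p ≈P p′
open _≋_ public

≋-refl : ∀ {p} → p ≋ p
≋-refl = mk≋ λ _ → refl

≋-sym : ∀ {p p′} → p ≋ p′ → p′ ≋ p
≋-sym e = mk≋ λ k → sym (coeff-≡ e k)

≋-trans : ∀ {p p′ p″} → p ≋ p′ → p′ ≋ p″ → p ≋ p″
≋-trans e f = mk≋ λ k → trans (coeff-≡ e k) (coeff-≡ f k)

≡⇒≋ : ∀ {p p′} → p ≡ p′ → p ≋ p′
≡⇒≋ refl = ≋-refl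

≋-setoid : Setoid _ _
≋-setoid = record
  { Carrier = Poly ; _≈_ = _≋_
  ; isEquivalence = record { refl = ≋-refl ; sym = ≋-sym ; trans = ≋-trans } }

module ≋-Reasoning = SetoidReasoning ≋-setoid

coeff-+P : ∀ p p′ k → coeff (p +P p′) k ≡ coeff p k ℤ.+ coeff p′ k
coeff-+P []      p′       k       = sym (ℤₚ.+-identityˡ _)
coeff-+P (a ∷ p) []       k       = sym (ℤₚ.+-identityʳ _)
coeff-+P (a ∷ p) (b ∷ p′) zero    = refl
coeff-+P (a ∷ p) (b ∷ p′) (suc k) = coeff-+P p p′ k

coeff-scaleP : ∀ c p k → coeff (scaleP c p) k ≡ c ℤ.* coeff p k
coeff-scaleP c []      k       = sym (ℤₚ.*-zeroʳ c)
coeff-scaleP c (a ∷ p) zero    = refl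
coeff-scaleP c (a ∷ p) (suc k) = coeff-scaleP c p k

∷-cong : ∀ {a b p p′} → a ≡ b → p ≋ p′ → a ∷ p ≋ b ∷ p′
∷-cong a≡b e = mk≋ λ { zero → a≡b ; (suc k) → coeff-≡ e k }

∷-tail : ∀ {a b p p′} → a ∷ p ≋ b ∷ p′ → p ≋ p′
∷-tail e = mk≋ λ k → coeff-≡ e (suc k)

0∷-[] : ∀ {p} → p ≋ [] → + 0 ∷ p ≋ []
0∷-[] e = mk≋ λ { zero → refl ; (suc k) → coeff-≡ e k }

+P-cong : ∀ {p p′ s s′} → p ≋ p′ → s ≋ s′ → p +P s ≋ p′ +P s′
+P-cong {p} {p′} {s} {s′} e f = mk≋ λ k → begin
  coeff (p +P s) k             ≡⟨ coeff-+P p s k ⟩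
  coeff p k ℤ.+ coeff s k      ≡⟨ cong₂ ℤ._+_ (coeff-≡ e k) (coeff-≡ f k) ⟩
  coeff p′ k ℤ.+ coeff s′ k    ≡⟨ coeff-+P p′ s′ k ⟨
  coeff (p′ +P s′) k           ∎
  where open ≡-Reasoning

+P-congˡ : ∀ p {s s′} → s ≋ s′ → p +P s ≋ p +P s′
+P-congˡ p = +P-cong (≋-refl {p})

+P-congʳ : ∀ s {p p′} → p ≋ p′ → p +P s ≋ p′ +P s
+P-congʳ s e = +P-cong e (≋-refl {s})

scaleP-cong : ∀ c {p p′} → p ≋ p′ → scaleP c p ≋ scaleP c p′
scaleP-cong c {p} {p′} e = mk≋ λ k → begin
  coeff (scaleP c p) k   ≡⟨ coeff-scaleP c p k ⟩
  c ℤ.* coeff p k        ≡⟨ cong (c ℤ.*_) (coeff-≡ e k) ⟩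
  c ℤ.* coeff p′ k       ≡⟨ coeff-scaleP c p′ k ⟨
  coeff (scaleP c p′) k  ∎
  where open ≡-Reasoning

+P-comm : ∀ p p′ → p +P p′ ≋ p′ +P p
+P-comm p p′ = mk≋ λ k → begin
  coeff (p +P p′) k          ≡⟨ coeff-+P p p′ k ⟩
  coeff p k ℤ.+ coeff p′ k   ≡⟨ ℤₚ.+-comm (coeff p k) _ ⟩
  coeff p′ k ℤ.+ coeff p k   ≡⟨ coeff-+P p′ p k ⟨
  coeff (p′ +P p) k          ∎
  where open ≡-Reasoning

+P-assoc : ∀ p p′ p″ → (p +P p′) +P p″ ≋ p +P (p′ +P p″)
+P-assoc p p′ p″ = mk≋ λ k → begin
  coeff ((p +P p′) +P p″) k                       ≡⟨ coeff-+P (p +P p′) p″ k ⟩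
  coeff (p +P p′) k ℤ.+ coeff p″ k                ≡⟨ cong (ℤ._+ coeff p″ k) (coeff-+P p p′ k) ⟩
  coeff p k ℤ.+ coeff p′ k ℤ.+ coeff p″ k         ≡⟨ ℤₚ.+-assoc (coeff p k) _ _ ⟩
  coeff p k ℤ.+ (coeff p′ k ℤ.+ coeff p″ k)       ≡⟨ cong (ℤ._+_ (coeff p k)) (coeff-+P p′ p″ k) ⟨
  coeff p k ℤ.+ coeff (p′ +P p″) k                ≡⟨ coeff-+P p (p′ +P p″) k ⟨
  coeff (p +P (p′ +P p″)) k                       ∎
  where open ≡-Reasoning

+P-identityʳ : ∀ p → p +P [] ≋ p
+P-identityʳ p = mk≋ λ k → trans (coeff-+P p [] k) (ℤₚ.+-identityʳ _)

+P-inverseʳ : ∀ p → p +P negP p ≋ []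
+P-inverseʳ p = mk≋ λ k → begin
  coeff (p +P negP p) k                   ≡⟨ coeff-+P p (negP p) k ⟩
  coeff p k ℤ.+ coeff (negP p) k          ≡⟨ cong (ℤ._+_ (coeff p k)) (coeff-scaleP (- + 1) p k) ⟩
  coeff p k ℤ.+ (- + 1) ℤ.* coeff p k     ≡⟨ cong (ℤ._+_ (coeff p k)) (ℤₚ.-1*i≡-i (coeff p k)) ⟩
  coeff p k ℤ.- coeff p k                 ≡⟨ ℤₚ.+-inverseʳ (coeff p k) ⟩
  + 0                                     ∎
  where open ≡-Reasoning

scaleP-distribˡ : ∀ c p p′ → scaleP c (p +P p′) ≋ scaleP c p +P scaleP c p′
scaleP-distribˡ c p p′ = mk≋ λ k → begin
  coeff (scaleP c (p +P p′)) k                          ≡⟨ coeff-scaleP c (p +P p′) k ⟩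
  c ℤ.* coeff (p +P p′) k                               ≡⟨ cong (c ℤ.*_) (coeff-+P p p′ k) ⟩
  c ℤ.* (coeff p k ℤ.+ coeff p′ k)                      ≡⟨ ℤₚ.*-distribˡ-+ c _ _ ⟩
  c ℤ.* coeff p k ℤ.+ c ℤ.* coeff p′ k                  ≡⟨ cong₂ ℤ._+_ (coeff-scaleP c p k) (coeff-scaleP c p′ k) ⟨
  coeff (scaleP c p) k ℤ.+ coeff (scaleP c p′) k        ≡⟨ coeff-+P (scaleP c p) (scaleP c p′) k ⟨
  coeff (scaleP c p +P scaleP c p′) k                   ∎
  where open ≡-Reasoning

scaleP-distribʳ : ∀ c c′ p → scaleP (c ℤ.+ c′) p ≋ scaleP c p +P scaleP c′ p
scaleP-distribʳ c c′ p = mk≋ λ k → begin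
  coeff (scaleP (c ℤ.+ c′) p) k                         ≡⟨ coeff-scaleP (c ℤ.+ c′) p k ⟩
  (c ℤ.+ c′) ℤ.* coeff p k                              ≡⟨ ℤₚ.*-distribʳ-+ (coeff p k) c c′ ⟩
  c ℤ.* coeff p k ℤ.+ c′ ℤ.* coeff p k                  ≡⟨ cong₂ ℤ._+_ (coeff-scaleP c p k) (coeff-scaleP c′ p k) ⟨
  coeff (scaleP c p) k ℤ.+ coeff (scaleP c′ p) k        ≡⟨ coeff-+P (scaleP c p) (scaleP c′ p) k ⟨
  coeff (scaleP c p +P scaleP c′ p) k                   ∎
  where open ≡-Reasoning

scaleP-scaleP : ∀ c c′ p → scaleP c (scaleP c′ p) ≋ scaleP (c ℤ.* c′) p
scaleP-scaleP c c′ p = mk≋ λ k → begin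
  coeff (scaleP c (scaleP c′ p)) k     ≡⟨ coeff-scaleP c (scaleP c′ p) k ⟩
  c ℤ.* coeff (scaleP c′ p) k          ≡⟨ cong (c ℤ.*_) (coeff-scaleP c′ p k) ⟩
  c ℤ.* (c′ ℤ.* coeff p k)             ≡⟨ ℤₚ.*-assoc c c′ _ ⟨
  c ℤ.* c′ ℤ.* coeff p k               ≡⟨ coeff-scaleP (c ℤ.* c′) p k ⟨
  coeff (scaleP (c ℤ.* c′) p) k        ∎
  where open ≡-Reasoning

scaleP-zero : ∀ p → scaleP (+ 0) p ≋ []
scaleP-zero p = mk≋ (coeff-scaleP (+ 0) p)

scaleP-identity : ∀ p → scaleP (+ 1) p ≋ p
scaleP-identity p = mk≋ λ k → trans (coeff-scaleP (+ 1) p k) (ℤₚ.*-identityˡ _)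

scaleP-0∷ : ∀ c p → scaleP c (+ 0 ∷ p) ≋ + 0 ∷ scaleP c p
scaleP-0∷ c p = ∷-cong (ℤₚ.*-zeroʳ c) ≋-refl

+P-interchange : ∀ p p′ s s′ → (p +P p′) +P (s +P s′) ≋ (p +P s) +P (p′ +P s′)
+P-interchange p p′ s s′ = mk≋ λ k → begin
  coeff ((p +P p′) +P (s +P s′)) k                         ≡⟨ coeff-+P (p +P p′) (s +P s′) k ⟩
  coeff (p +P p′) k ℤ.+ coeff (s +P s′) k                  ≡⟨ cong₂ ℤ._+_ (coeff-+P p p′ k) (coeff-+P s s′ k) ⟩
  (coeff p k ℤ.+ coeff p′ k) ℤ.+ (coeff s k ℤ.+ coeff s′ k) ≡⟨ ℤ+.interchange (coeff p k) _ _ _ ⟩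
  (coeff p k ℤ.+ coeff s k) ℤ.+ (coeff p′ k ℤ.+ coeff s′ k) ≡⟨ cong₂ ℤ._+_ (coeff-+P p s k) (coeff-+P p′ s′ k) ⟨
  coeff (p +P s) k ℤ.+ coeff (p′ +P s′) k                  ≡⟨ coeff-+P (p +P s) (p′ +P s′) k ⟨
  coeff ((p +P s) +P (p′ +P s′)) k                         ∎
  where open ≡-Reasoning

*P-zeroʳ : ∀ p → p *P [] ≋ []
*P-zeroʳ []      = ≋-refl
*P-zeroʳ (a ∷ p) = 0∷-[] (*P-zeroʳ p)

*P-zeroˡ : ∀ {p} s → p ≋ [] → p *P s ≋ []
*P-zeroˡ {[]}    s e = ≋-refl
*P-zeroˡ {a ∷ p} s e = +P-cong a·s≋[] (0∷-[] (*P-zeroˡ {p} s (mk≋ λ k → coeff-≡ e (suc k))))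
  where
  a·s≋[] : scaleP a s ≋ []
  a·s≋[] = mk≋ λ k → begin
    coeff (scaleP a s) k     ≡⟨ coeff-scaleP a s k ⟩
    a ℤ.* coeff s k          ≡⟨ cong (ℤ._* coeff s k) (coeff-≡ e zero) ⟩
    + 0 ℤ.* coeff s k        ≡⟨ ℤₚ.*-zeroˡ (coeff s k) ⟩
    + 0                      ∎
    where open ≡-Reasoning

*P-congʳ : ∀ {p p′} s → p ≋ p′ → p *P s ≋ p′ *P s
*P-congʳ {[]}    {p′}     s e = ≋-sym (*P-zeroˡ s (≋-sym e))
*P-congʳ {a ∷ p} {[]}     s e = *P-zeroˡ s e
*P-congʳ {a ∷ p} {b ∷ p′} s e =
  +P-cong (≡⇒≋ (cong (λ c → scaleP c s) (coeff-≡ e zero))) (∷-cong refl (*P-congʳ s (∷-tail e)))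

*P-congˡ : ∀ p {s s′} → s ≋ s′ → p *P s ≋ p *P s′
*P-congˡ []      e = ≋-refl
*P-congˡ (a ∷ p) e = +P-cong (scaleP-cong a e) (∷-cong refl (*P-congˡ p e))

*P-cong : ∀ {p p′ s s′} → p ≋ p′ → s ≋ s′ → p *P s ≋ p′ *P s′
*P-cong {p′ = p′} {s} e f = ≋-trans (*P-congʳ s e) (*P-congˡ p′ f)

*P-distribʳ : ∀ s p p′ → (p +P p′) *P s ≋ p *P s +P p′ *P s
*P-distribʳ s []      p′       = ≋-refl
*P-distribʳ s (a ∷ p) []       = ≋-sym (+P-identityʳ _)
*P-distribʳ s (a ∷ p) (b ∷ p′) =
  ≋-trans (+P-cong (scaleP-distribʳ a b s) (∷-cong refl (*P-distribʳ s p p′)))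
          (+P-interchange (scaleP a s) (scaleP b s) (+ 0 ∷ p *P s) (+ 0 ∷ p′ *P s))

*P-distribˡ : ∀ p s s′ → p *P (s +P s′) ≋ p *P s +P p *P s′
*P-distribˡ []      s s′ = ≋-refl
*P-distribˡ (a ∷ p) s s′ =
  ≋-trans (+P-cong (scaleP-distribˡ a s s′) (∷-cong refl (*P-distribˡ p s s′)))
          (+P-interchange (scaleP a s) (scaleP a s′) (+ 0 ∷ p *P s) (+ 0 ∷ p *P s′))

scaleP-*P : ∀ c p s → scaleP c (p *P s) ≋ scaleP c p *P s
scaleP-*P c []      s = ≋-refl
scaleP-*P c (a ∷ p) s =
  ≋-trans (scaleP-distribˡ c (scaleP a s) (+ 0 ∷ p *P s))
          (+P-cong (scaleP-scaleP c a s) (≋-trans (scaleP-0∷ c (p *P s)) (∷-cong refl (scaleP-*P c p s))))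

*P-0∷ʳ : ∀ p s → p *P (+ 0 ∷ s) ≋ + 0 ∷ p *P s
*P-0∷ʳ []      s = ≋-sym (0∷-[] ≋-refl)
*P-0∷ʳ (a ∷ p) s = +P-cong (scaleP-0∷ a s) (∷-cong refl (*P-0∷ʳ p s))

*P-0∷ˡ : ∀ p s → (+ 0 ∷ p) *P s ≋ + 0 ∷ p *P s
*P-0∷ˡ p s = +P-cong (scaleP-zero s) ≋-refl

*P-constP : ∀ p c → p *P constP c ≋ scaleP c p
*P-constP []      c = ≋-refl
*P-constP (a ∷ p) c = mk≋ λ
  { zero    → trans (ℤₚ.+-identityʳ _) (ℤₚ.*-comm a c)
  ; (suc k) → coeff-≡ (*P-constP p c) k }

*P-comm : ∀ p s → p *P s ≋ s *P p
*P-comm []      s = ≋-sym (*P-zeroʳ s)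
*P-comm (a ∷ p) s = ≋-sym (begin
  s *P (a ∷ p)                         ≈⟨ *P-congˡ s a∷p≋a+0∷p ⟩
  s *P (constP a +P (+ 0 ∷ p))         ≈⟨ *P-distribˡ s (constP a) (+ 0 ∷ p) ⟩
  s *P constP a +P s *P (+ 0 ∷ p)      ≈⟨ +P-cong (*P-constP s a) (*P-0∷ʳ s p) ⟩
  scaleP a s +P (+ 0 ∷ s *P p)         ≈⟨ +P-congˡ (scaleP a s) (∷-cong refl (*P-comm s p)) ⟩
  scaleP a s +P (+ 0 ∷ p *P s)         ∎)
  where
  open ≋-Reasoning
  a∷p≋a+0∷p : a ∷ p ≋ constP a +P (+ 0 ∷ p)
  a∷p≋a+0∷p = ∷-cong (sym (ℤₚ.+-identityʳ a)) ≋-refl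

*P-assoc : ∀ p s s′ → (p *P s) *P s′ ≋ p *P (s *P s′)
*P-assoc []      s s′ = ≋-refl
*P-assoc (a ∷ p) s s′ = begin
  (scaleP a s +P (+ 0 ∷ p *P s)) *P s′            ≈⟨ *P-distribʳ s′ (scaleP a s) _ ⟩
  scaleP a s *P s′ +P (+ 0 ∷ p *P s) *P s′        ≈⟨ +P-cong (≋-sym (scaleP-*P a s s′)) (*P-0∷ˡ (p *P s) s′) ⟩
  scaleP a (s *P s′) +P (+ 0 ∷ (p *P s) *P s′)    ≈⟨ +P-congˡ (scaleP a (s *P s′)) (∷-cong refl (*P-assoc p s s′)) ⟩
  scaleP a (s *P s′) +P (+ 0 ∷ p *P (s *P s′))    ∎
  where open ≋-Reasoning

*P-identityˡ : ∀ p → constP (+ 1) *P p ≋ p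
*P-identityˡ p = ≋-trans (+P-cong (scaleP-identity p) (0∷-[] ≋-refl)) (+P-identityʳ p)

*P-identityʳ : ∀ p → p *P constP (+ 1) ≋ p
*P-identityʳ p = ≋-trans (*P-constP p (+ 1)) (scaleP-identity p)

ℤ[q]-isCommutativeRing : IsCommutativeRing _≋_ _+P_ _*P_ negP [] (constP (+ 1))
ℤ[q]-isCommutativeRing = record
  { isRing = record
    { +-isAbelianGroup = record
      { isGroup = record
        { isMonoid = record
          { isSemigroup = record
            { isMagma = record { isEquivalence = Setoid.isEquivalence ≋-setoid ; ∙-cong = +P-cong }
            ; assoc = +P-assoc }
          ; identity = (λ _ → ≋-refl) , +P-identityʳ }
        ; inverse = (λ p → ≋-trans (+P-comm (negP p) p) (+P-inverseʳ p)) , +P-inverseʳ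
        ; ⁻¹-cong = scaleP-cong (- + 1) }
      ; comm = +P-comm }
    ; *-cong = *P-cong
    ; *-assoc = *P-assoc
    ; *-identity = *P-identityˡ , *P-identityʳ
    ; distrib = *P-distribˡ , *P-distribʳ }
  ; *-comm = *P-comm }

ℤ[q] : CommutativeRing _ _
ℤ[q] = record { isCommutativeRing = ℤ[q]-isCommutativeRing }

isZero? : (p : Poly) → Maybe ([] ≋ p)
isZero? []      = just ≋-refl
isZero? (a ∷ p) with a ℤ.≟ + 0 | isZero? p
... | yes refl | just e = just (≋-sym (0∷-[] (≋-sym e)))
... | _        | _      = nothing

module ℤ[q]-Solver = NonReflective (fromCommutativeRing ℤ[q] isZero?)
open ℤ[q]-Solver using (solve; _⊕_; _⊗_; ⊝_; _⊜_; Κ)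

^P-congˡ : ∀ n {p p′} → p ≋ p′ → p ^P n ≋ p′ ^P n
^P-congˡ zero    e = ≋-refl
^P-congˡ (suc n) e = *P-cong e (^P-congˡ n e)

^P-distrib-*P : ∀ p s n → (p *P s) ^P n ≋ p ^P n *P s ^P n
^P-distrib-*P p s zero    = ≋-sym (*P-identityˡ (constP (+ 1)))
^P-distrib-*P p s (suc n) = ≋-trans (*P-congˡ (p *P s) (^P-distrib-*P p s n))
  (solve 4 (λ p s x y → ((p ⊗ s) ⊗ (x ⊗ y)) ⊜ ((p ⊗ x) ⊗ (s ⊗ y))) ≋-refl p s (p ^P n) (s ^P n))

natP : ℕ → Poly
natP k = constP (+ k)

q-1 : Poly
q-1 = qP +P constP (- + 1)

qP-*P : ∀ p → qP *P p ≋ + 0 ∷ p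
qP-*P p = +P-cong (scaleP-zero p) (∷-cong refl (*P-identityˡ p))
monoP-scaleP : ∀ c c′ e → monoP (c ℤ.* c′) e ≋ scaleP c (monoP c′ e)
monoP-scaleP c c′ zero    = ≋-refl
monoP-scaleP c c′ (suc e) = ∷-cong (sym (ℤₚ.*-zeroʳ c)) (monoP-scaleP c c′ e)

monoP-+ : ∀ c e e′ → monoP c (e ℕ.+ e′) ≋ monoP c e *P monoP (+ 1) e′
monoP-+ c zero    e′ = begin
  monoP c e′                                   ≡⟨ cong (λ c′ → monoP c′ e′) (ℤₚ.*-identityʳ c) ⟨
  monoP (c ℤ.* + 1) e′                         ≈⟨ monoP-scaleP c (+ 1) e′ ⟩
  scaleP c (monoP (+ 1) e′)                    ≈⟨ +P-identityʳ _ ⟨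
  scaleP c (monoP (+ 1) e′) +P []              ≈⟨ +P-congˡ (scaleP c (monoP (+ 1) e′)) (0∷-[] ≋-refl) ⟨
  constP c *P monoP (+ 1) e′                   ∎
  where open ≋-Reasoning
monoP-+ c (suc e) e′ =
  ≋-trans (∷-cong refl (monoP-+ c e e′)) (≋-sym (*P-0∷ˡ (monoP c e) (monoP (+ 1) e′)))

-- The Euler operator q d/dq, acting on coefficients by aₖ ↦ k aₖ.
θ : Poly → Poly
θ []      = []
θ (a ∷ p) = + 0 ∷ (θ p +P p)

coeff-θ : ∀ p k → coeff (θ p) k ≡ + k ℤ.* coeff p k
coeff-θ []      k       = sym (ℤₚ.*-zeroʳ (+ k))
coeff-θ (a ∷ p) zero    = sym (ℤₚ.*-zeroˡ a)
coeff-θ (a ∷ p) (suc k) = begin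
  coeff (θ p +P p) k                          ≡⟨ coeff-+P (θ p) p k ⟩
  coeff (θ p) k ℤ.+ coeff p k                 ≡⟨ cong (ℤ._+ coeff p k) (coeff-θ p k) ⟩
  + k ℤ.* coeff p k ℤ.+ coeff p k             ≡⟨ ℤₚ.+-comm (+ k ℤ.* coeff p k) _ ⟩
  coeff p k ℤ.+ + k ℤ.* coeff p k             ≡⟨ cong (ℤ._+ (+ k ℤ.* coeff p k)) (ℤₚ.*-identityˡ (coeff p k)) ⟨
  + 1 ℤ.* coeff p k ℤ.+ + k ℤ.* coeff p k     ≡⟨ ℤₚ.*-distribʳ-+ (coeff p k) (+ 1) (+ k) ⟨
  + suc k ℤ.* coeff p k                       ∎
  where open ≡-Reasoning

θ-cong : ∀ {p p′} → p ≋ p′ → θ p ≋ θ p′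
θ-cong {p} {p′} e = mk≋ λ k → begin
  coeff (θ p) k       ≡⟨ coeff-θ p k ⟩
  + k ℤ.* coeff p k   ≡⟨ cong (+ k ℤ.*_) (coeff-≡ e k) ⟩
  + k ℤ.* coeff p′ k  ≡⟨ coeff-θ p′ k ⟨
  coeff (θ p′) k      ∎
  where open ≡-Reasoning

θ-+P : ∀ p p′ → θ (p +P p′) ≋ θ p +P θ p′
θ-+P p p′ = mk≋ λ k → begin
  coeff (θ (p +P p′)) k                            ≡⟨ coeff-θ (p +P p′) k ⟩
  + k ℤ.* coeff (p +P p′) k                        ≡⟨ cong (+ k ℤ.*_) (coeff-+P p p′ k) ⟩
  + k ℤ.* (coeff p k ℤ.+ coeff p′ k)               ≡⟨ ℤₚ.*-distribˡ-+ (+ k) _ _ ⟩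
  + k ℤ.* coeff p k ℤ.+ + k ℤ.* coeff p′ k         ≡⟨ cong₂ ℤ._+_ (coeff-θ p k) (coeff-θ p′ k) ⟨
  coeff (θ p) k ℤ.+ coeff (θ p′) k                 ≡⟨ coeff-+P (θ p) (θ p′) k ⟨
  coeff (θ p +P θ p′) k                            ∎
  where open ≡-Reasoning

θ-scaleP : ∀ c p → θ (scaleP c p) ≋ scaleP c (θ p)
θ-scaleP c p = mk≋ λ k → begin
  coeff (θ (scaleP c p)) k         ≡⟨ coeff-θ (scaleP c p) k ⟩
  + k ℤ.* coeff (scaleP c p) k     ≡⟨ cong (+ k ℤ.*_) (coeff-scaleP c p k) ⟩
  + k ℤ.* (c ℤ.* coeff p k)        ≡⟨ ℤ*.x∙yz≈y∙xz (+ k) c (coeff p k) ⟩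
  c ℤ.* (+ k ℤ.* coeff p k)        ≡⟨ cong (c ℤ.*_) (coeff-θ p k) ⟨
  c ℤ.* coeff (θ p) k              ≡⟨ coeff-scaleP c (θ p) k ⟨
  coeff (scaleP c (θ p)) k         ∎
  where open ≡-Reasoning

θ-*P : ∀ p s → θ (p *P s) ≋ θ p *P s +P p *P θ s
θ-*P []      s = ≋-refl
θ-*P (a ∷ p) s = begin
  θ (scaleP a s +P (+ 0 ∷ p *P s))                           ≈⟨ θ-+P (scaleP a s) _ ⟩
  θ (scaleP a s) +P (+ 0 ∷ θ (p *P s) +P p *P s)             ≈⟨ +P-cong (θ-scaleP a s) (≋-sym (qP-*P _)) ⟩
  scaleP a (θ s) +P qP *P (θ (p *P s) +P p *P s)             ≈⟨ +P-congˡ (scaleP a (θ s)) (*P-congˡ qP (+P-congʳ (p *P s) (θ-*P p s))) ⟩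
  scaleP a (θ s) +P qP *P ((θ p *P s +P p *P θ s) +P p *P s)
    ≈⟨ solve 5 (λ A X U V W → (A ⊕ X ⊗ (U ⊕ V ⊕ W)) ⊜ (X ⊗ (U ⊕ W) ⊕ (A ⊕ X ⊗ V))) ≋-refl
         (scaleP a (θ s)) qP (θ p *P s) (p *P θ s) (p *P s) ⟩
  qP *P (θ p *P s +P p *P s) +P (scaleP a (θ s) +P qP *P (p *P θ s))
    ≈⟨ +P-cong (≋-trans (*P-congˡ qP (≋-sym (*P-distribʳ s (θ p) p)))
                 (≋-trans (≋-sym (*P-assoc qP (θ p +P p) s)) (*P-congʳ s (qP-*P (θ p +P p)))))
               (+P-congˡ (scaleP a (θ s)) (qP-*P (p *P θ s))) ⟩
  (+ 0 ∷ θ p +P p) *P s +P (a ∷ p) *P θ s                    ∎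
  where open ≋-Reasoning

θ-monoP : ∀ c e → θ (monoP c e) ≋ natP e *P monoP c e
θ-monoP c zero    = ≋-trans (0∷-[] ≋-refl) (≋-sym (*P-zeroˡ (monoP c zero) (0∷-[] ≋-refl)))
θ-monoP c (suc e) = begin
  + 0 ∷ θ (monoP c e) +P monoP c e                  ≈⟨ ∷-cong refl (+P-congʳ (monoP c e) (θ-monoP c e)) ⟩
  + 0 ∷ natP e *P monoP c e +P monoP c e            ≈⟨ ∷-cong refl (solve 2 (λ n m → (n ⊗ m ⊕ m) ⊜ ((Κ (constP (+ 1)) ⊕ n) ⊗ m)) ≋-refl (natP e) (monoP c e)) ⟩
  + 0 ∷ natP (suc e) *P monoP c e                   ≈⟨ *P-0∷ʳ (natP (suc e)) (monoP c e) ⟨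
  natP (suc e) *P (+ 0 ∷ monoP c e)                 ∎
  where open ≋-Reasoning

θ-[q-1]^ : ∀ m → q-1 *P θ (q-1 ^P m) ≋ natP m *P (qP *P q-1 ^P m)
θ-[q-1]^ zero    = ≋-trans (*P-congˡ q-1 (0∷-[] ≋-refl)) (≋-trans (*P-zeroʳ q-1) (≋-sym (*P-zeroˡ (qP *P q-1 ^P zero) (0∷-[] ≋-refl))))
θ-[q-1]^ (suc m) = begin
  q-1 *P θ (q-1 *P q-1 ^P m)                                    ≈⟨ *P-congˡ q-1 (θ-*P q-1 (q-1 ^P m)) ⟩
  q-1 *P (θ q-1 *P q-1 ^P m +P q-1 *P θ (q-1 ^P m))             ≈⟨ *P-congˡ q-1 (+P-cong (*P-congʳ (q-1 ^P m) θ-q-1) (θ-[q-1]^ m)) ⟩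
  q-1 *P (qP *P q-1 ^P m +P natP m *P (qP *P q-1 ^P m))
    ≈⟨ solve 4 (λ x q y n → (x ⊗ (q ⊗ y ⊕ n ⊗ (q ⊗ y))) ⊜ ((Κ (constP (+ 1)) ⊕ n) ⊗ (q ⊗ (x ⊗ y)))) ≋-refl q-1 qP (q-1 ^P m) (natP m) ⟩
  natP (suc m) *P (qP *P (q-1 *P q-1 ^P m))                     ∎
  where
  open ≋-Reasoning
  θ-q-1 : θ q-1 ≋ qP
  θ-q-1 = mk≋ λ { zero → refl ; (suc zero) → refl ; (suc (suc k)) → refl }

sumP-map : ∀ {A B : Set} (F : B → Poly) (g : A → B) xs → sumP (map F (map g xs)) ≡ sumP (map (F ∘ g) xs)
sumP-map F g xs = cong sumP (sym (Listₚ.map-∘ xs))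

sumP-++ : ∀ (xs ys : List Poly) → sumP (xs ++ ys) ≋ sumP xs +P sumP ys
sumP-++ []       ys = ≋-refl
sumP-++ (x ∷ xs) ys = ≋-trans (+P-congˡ x (sumP-++ xs ys)) (≋-sym (+P-assoc x (sumP xs) (sumP ys)))

module _ {A : Set} where

  sumP-cong : ∀ {F G : A → Poly} xs → (∀ {x} → x ∈ xs → F x ≋ G x) → sumP (map F xs) ≋ sumP (map G xs)
  sumP-cong []       e = ≋-refl
  sumP-cong (x ∷ xs) e = +P-cong (e (here refl)) (sumP-cong xs (e ∘ there))

  sumP-cong′ : ∀ {F G : A → Poly} xs → (∀ x → F x ≋ G x) → sumP (map F xs) ≋ sumP (map G xs)
  sumP-cong′ xs e = sumP-cong xs λ {x} _ → e x

  sumP-↭ : ∀ (F : A → Poly) {xs ys} → xs ↭ ys → sumP (map F xs) ≋ sumP (map F ys)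
  sumP-↭ F xs↭ys = ↭ₛ.foldr-commMonoid ≋-setoid (CommutativeRing.+-isCommutativeMonoid ℤ[q])
    (↭⇒↭ₛ′ (Setoid.isEquivalence ≋-setoid) (↭.map⁺ F xs↭ys))

  sumP-homo : (L : Poly → Poly) → L [] ≋ [] → (∀ p s → L (p +P s) ≋ L p +P L s) →
              ∀ (F : A → Poly) xs → L (sumP (map F xs)) ≋ sumP (map (L ∘ F) xs)
  sumP-homo L L-[] L-+ F []       = L-[]
  sumP-homo L L-[] L-+ F (x ∷ xs) = ≋-trans (L-+ (F x) _) (+P-congˡ (L (F x)) (sumP-homo L L-[] L-+ F xs))

  *P-distribˡ-sumP : ∀ p (F : A → Poly) xs → p *P sumP (map F xs) ≋ sumP (map (λ x → p *P F x) xs)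
  *P-distribˡ-sumP p = sumP-homo (p *P_) (*P-zeroʳ p) (*P-distribˡ p)

  *P-distribʳ-sumP : ∀ p (F : A → Poly) xs → sumP (map F xs) *P p ≋ sumP (map (λ x → F x *P p) xs)
  *P-distribʳ-sumP p = sumP-homo (_*P p) ≋-refl (*P-distribʳ p)

  sumP-+P : ∀ (F G : A → Poly) xs → sumP (map (λ x → F x +P G x) xs) ≋ sumP (map F xs) +P sumP (map G xs)
  sumP-+P F G []       = ≋-refl
  sumP-+P F G (x ∷ xs) = ≋-trans (+P-congˡ (F x +P G x) (sumP-+P F G xs))
                                 (+P-interchange (F x) (G x) (sumP (map F xs)) (sumP (map G xs)))

module _ {A B : Set} where

  sumP-comm : ∀ (F : A → B → Poly) xs ys →
              sumP (map (λ x → sumP (map (F x) ys)) xs) ≋ sumP (map (λ y → sumP (map (λ x → F x y) xs)) ys)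
  sumP-comm F []       ys = ≋-sym (sumP-zero ys)
    where
    sumP-zero : ∀ (ys : List B) → sumP (map (λ _ → []) ys) ≋ []
    sumP-zero []       = ≋-refl
    sumP-zero (_ ∷ ys) = sumP-zero ys
  sumP-comm F (x ∷ xs) ys = ≋-trans (+P-congˡ (sumP (map (F x) ys)) (sumP-comm F xs ys))
                                    (≋-sym (sumP-+P (F x) (λ y → sumP (map (λ x → F x y) xs)) ys))

  sumP-cartesianProductWith : ∀ {C : Set} (F : C → Poly) (h : A → B → C) xs ys →
    sumP (map F (cartesianProductWith h xs ys)) ≋ sumP (map (λ x → sumP (map (λ y → F (h x y)) ys)) xs)
  sumP-cartesianProductWith F h []       ys = ≋-refl
  sumP-cartesianProductWith F h (x ∷ xs) ys = begin
    sumP (map F (map (h x) ys ++ cartesianProductWith h xs ys))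
      ≡⟨ cong sumP (Listₚ.map-++ F (map (h x) ys) _) ⟩
    sumP (map F (map (h x) ys) ++ map F (cartesianProductWith h xs ys))
      ≈⟨ sumP-++ (map F (map (h x) ys)) _ ⟩
    sumP (map F (map (h x) ys)) +P sumP (map F (cartesianProductWith h xs ys))
      ≈⟨ +P-cong (≡⇒≋ (sumP-map F (h x) ys)) (sumP-cartesianProductWith F h xs ys) ⟩
    sumP (map (λ y → F (h x y)) ys) +P sumP (map (λ x → sumP (map (λ y → F (h x y)) ys)) xs) ∎
    where open ≋-Reasoning

open SemiringSum (CommutativeRing.semiring ℤ[q]) using ()
  renaming (sum to ΣP; sum-init-last to ΣP-init-last; sum-cong-≋ to ΣP-cong; *-distribˡ-sum to *P-distribˡ-ΣP)

sumP-allFin : ∀ n (F : Fin n → Poly) → sumP (map F (allFin n)) ≡ ΣP F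
sumP-allFin n F = trans (cong sumP (Listₚ.map-tabulate (λ i → i) F)) (sumP-tabulate n F)
  where
  sumP-tabulate : ∀ n (F : Fin n → Poly) → sumP (List.tabulate F) ≡ ΣP F
  sumP-tabulate zero    F = refl
  sumP-tabulate (suc n) F = cong (F Fin.zero +P_) (sumP-tabulate n (F ∘ Fin.suc))

open SemiringSum ℕₚ.+-*-semiring using ()
  renaming (sum to Σℕ; sum-init-last to Σℕ-init-last; sum-cong-≗ to Σℕ-cong; ∑-distrib-+ to Σℕ-distrib-+;
            *-distribˡ-sum to *-distribˡ-Σℕ)

iverson : ∀ {P : Set} → Dec P → ℕ
iverson (yes _) = 1
iverson (no _)  = 0

iverson-cong : ∀ {P Q : Set} → P ⇔ Q → (p : Dec P) (q : Dec Q) → iverson p ≡ iverson q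
iverson-cong P⇔Q (yes p) (yes q) = refl
iverson-cong P⇔Q (yes p) (no ¬q) = contradiction (Equivalence.to P⇔Q p) ¬q
iverson-cong P⇔Q (no ¬p) (yes q) = contradiction (Equivalence.from P⇔Q q) ¬p
iverson-cong P⇔Q (no ¬p) (no ¬q) = refl

iverson-yes : ∀ {P : Set} → P → (p : Dec P) → iverson p ≡ 1
iverson-yes x (yes _) = refl
iverson-yes x (no ¬x) = contradiction x ¬x

iverson-no : ∀ {P : Set} → ¬ P → (p : Dec P) → iverson p ≡ 0
iverson-no ¬x (yes x) = contradiction x ¬x
iverson-no ¬x (no _)  = refl

iverson-<-+-≥ : ∀ a b → iverson (a <? b) ℕ.+ iverson (b ≤? a) ≡ 1
iverson-<-+-≥ a b with a <? b | b ≤? a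
... | yes a<b | yes b≤a = contradiction b≤a (ℕₚ.<⇒≱ a<b)
... | yes _   | no  _   = refl
... | no  _   | yes _   = refl
... | no  a≮b | no  b≰a = contradiction (ℕₚ.≮⇒≥ a≮b) b≰a

Σℕ-const-1 : ∀ n → Σℕ {n} (λ _ → 1) ≡ n
Σℕ-const-1 zero    = refl
Σℕ-const-1 (suc n) = cong suc (Σℕ-const-1 n)

Σℕ-update : ∀ {n} (h h′ : Fin n → ℕ) j → (∀ i → i ≢ j → h′ i ≡ h i) → Σℕ h′ ℕ.+ h j ≡ Σℕ h ℕ.+ h′ j
Σℕ-update {suc n} h h′ Fin.zero agree
  rewrite Σℕ-cong {n} {h′ ∘ Fin.suc} {h ∘ Fin.suc} (λ i → agree (Fin.suc i) λ ()) = begin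
  h′ Fin.zero ℕ.+ s ℕ.+ h Fin.zero     ≡⟨ ℕₚ.+-comm (h′ Fin.zero ℕ.+ s) _ ⟩
  h Fin.zero ℕ.+ (h′ Fin.zero ℕ.+ s)   ≡⟨ cong (h Fin.zero ℕ.+_) (ℕₚ.+-comm (h′ Fin.zero) s) ⟩
  h Fin.zero ℕ.+ (s ℕ.+ h′ Fin.zero)   ≡⟨ ℕₚ.+-assoc (h Fin.zero) s (h′ Fin.zero) ⟨
  h Fin.zero ℕ.+ s ℕ.+ h′ Fin.zero     ∎
  where
  open ≡-Reasoning
  s = Σℕ (h ∘ Fin.suc)
Σℕ-update {suc n} h h′ (Fin.suc j) agree
  rewrite agree Fin.zero (λ ())
  = trans (ℕₚ.+-assoc (h Fin.zero) _ _) (trans (cong (h Fin.zero ℕ.+_) rest) (sym (ℕₚ.+-assoc (h Fin.zero) _ _)))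
  where rest = Σℕ-update (h ∘ Fin.suc) (h′ ∘ Fin.suc) j (λ i i≢j → agree (Fin.suc i) (i≢j ∘ Finₚ.suc-injective))

ΣP-monoP-iverson : ∀ {n} {P : Fin n → Set} (P? : ∀ i → Dec (P i)) →
                   ΣP (λ i → monoP (+ 1) (iverson (P? i))) ≋ natP n +P natP (Σℕ (iverson ∘ P?)) *P q-1
ΣP-monoP-iverson {zero}  P? = ≋-sym (≋-trans (+P-congˡ (natP 0) (*P-zeroˡ q-1 (0∷-[] ≋-refl))) (0∷-[] ≋-refl))
ΣP-monoP-iverson {suc n} P? = begin
  monoP (+ 1) b +P ΣP (λ i → monoP (+ 1) (iverson (P? (Fin.suc i))))
    ≈⟨ +P-cong (monoP-iverson (P? Fin.zero)) (ΣP-monoP-iverson (P? ∘ Fin.suc)) ⟩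
  (constP (+ 1) +P natP b *P q-1) +P (natP n +P natP B *P q-1)
    ≈⟨ solve 4 (λ b n B x → ((Κ (constP (+ 1)) ⊕ b ⊗ x) ⊕ (n ⊕ B ⊗ x)) ⊜ ((Κ (constP (+ 1)) ⊕ n) ⊕ (b ⊕ B) ⊗ x)) ≋-refl
         (natP b) (natP n) (natP B) q-1 ⟩
  natP (suc n) +P natP (b ℕ.+ B) *P q-1 ∎
  where
  open ≋-Reasoning
  b = iverson (P? Fin.zero)
  B = Σℕ (iverson ∘ P? ∘ Fin.suc)
  monoP-iverson : ∀ {Q : Set} (d : Dec Q) → monoP (+ 1) (iverson d) ≋ constP (+ 1) +P natP (iverson d) *P q-1
  monoP-iverson (yes _) = mk≋ λ { zero → refl ; (suc zero) → refl ; (suc (suc k)) → refl }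
  monoP-iverson (no _)  = mk≋ λ { zero → refl ; (suc zero) → refl ; (suc (suc k)) → refl }

countFin≡Σℕ : ∀ n {P : Fin n → Set} (P? : ∀ i → Dec (P i)) → countFin n P? ≡ Σℕ (iverson ∘ P?)
countFin≡Σℕ n P? = count-tabulate n (λ i → i)
  where
  count-tabulate : ∀ m (g : Fin m → Fin n) → length (filter P? (List.tabulate g)) ≡ Σℕ (iverson ∘ P? ∘ g)
  count-tabulate zero    g = refl
  count-tabulate (suc m) g with P? (g Fin.zero)
  ... | yes _ = cong suc (count-tabulate m (g ∘ Fin.suc))
  ... | no  _ = count-tabulate m (g ∘ Fin.suc)

sum-allFin : ∀ n (h : Fin n → ℕ) → sum (map h (allFin n)) ≡ Σℕ h
sum-allFin n h = trans (cong sum (Listₚ.map-tabulate (λ i → i) h)) (sum-tabulate n h)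
  where
  sum-tabulate : ∀ n (h : Fin n → ℕ) → sum (List.tabulate h) ≡ Σℕ h
  sum-tabulate zero    h = refl
  sum-tabulate (suc n) h = cong (h Fin.zero ℕ.+_) (sum-tabulate n (h ∘ Fin.suc))

-- Permutations of Fin n and insertion of a new largest letter

module _ {m : ℕ} (f : Fin m → Fin m) where

  iterate : ℕ → Fin m → Fin m
  iterate zero    x = x
  iterate (suc k) x = f (iterate k x)

  iterate-+ : ∀ a b x → iterate (a ℕ.+ b) x ≡ iterate a (iterate b x)
  iterate-+ zero    b x = refl
  iterate-+ (suc a) b x = cong f (iterate-+ a b x)

  iterate-*-period : ∀ {p x} → iterate p x ≡ x → ∀ c → iterate (c ℕ.* p) x ≡ x
  iterate-*-period         fᵖx≡x zero    = refl
  iterate-*-period {p} {x} fᵖx≡x (suc c) =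
    trans (iterate-+ p (c ℕ.* p) x) (trans (cong (iterate p) (iterate-*-period fᵖx≡x c)) fᵖx≡x)

  module _ (f-inj : Injective _≡_ _≡_ f) where

    iterate-injective : ∀ k → Injective _≡_ _≡_ (iterate k)
    iterate-injective zero    eq = eq
    iterate-injective (suc k) eq = iterate-injective k (f-inj eq)

    -- Two of x, f x, …, fᵐ x coincide; injectivity turns that into a period of x.
    period : ∀ x → ∃ λ p → 0 < p × p ≤ m × iterate p x ≡ x
    period x with Finₚ.pigeonhole (ℕₚ.n<1+n m) (λ (k : Fin (suc m)) → iterate (toℕ k) x)
    ... | i , j , i<j , fⁱx≡fʲx = toℕ j ∸ toℕ i , ℕₚ.m<n⇒0<n∸m i<j , j∸i≤m , sym (iterate-injective (toℕ i) fⁱx≡fⁱ⁺⁽ʲ⁻ⁱ⁾x)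
      where
      j∸i≤m : toℕ j ∸ toℕ i ≤ m
      j∸i≤m = ℕₚ.≤-trans (ℕₚ.m∸n≤m (toℕ j) (toℕ i)) (ℕ.s≤s⁻¹ (Finₚ.toℕ<n j))
      fⁱx≡fⁱ⁺⁽ʲ⁻ⁱ⁾x : iterate (toℕ i) x ≡ iterate (toℕ i) (iterate (toℕ j ∸ toℕ i) x)
      fⁱx≡fⁱ⁺⁽ʲ⁻ⁱ⁾x = trans fⁱx≡fʲx (trans (cong (λ t → iterate t x) (sym (ℕₚ.m+[n∸m]≡n (ℕₚ.<⇒≤ i<j))))
                                             (iterate-+ (toℕ i) _ x))

    orbit-bounded : ∀ x t → ∃ λ (k : Fin m) → iterate t x ≡ iterate (toℕ k) x
    orbit-bounded x t with period x
    ... | p@(suc _) , _ , p≤m , fᵖx≡x = fromℕ< t%p<m , (begin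
      iterate t x                                   ≡⟨ cong (λ s → iterate s x) (m≡m%n+[m/n]*n t p) ⟩
      iterate (t % p ℕ.+ (t / p) ℕ.* p) x           ≡⟨ iterate-+ (t % p) _ x ⟩
      iterate (t % p) (iterate ((t / p) ℕ.* p) x)   ≡⟨ cong (iterate (t % p)) (iterate-*-period fᵖx≡x (t / p)) ⟩
      iterate (t % p) x                             ≡⟨ cong (λ s → iterate s x) (Finₚ.toℕ-fromℕ< t%p<m) ⟨
      iterate (toℕ (fromℕ< t%p<m)) x                ∎)
      where
      open ≡-Reasoning
      t%p<m : t % p < m
      t%p<m = ℕₚ.<-≤-trans (m%n<n t p) p≤m

  OrbitMin : Fin m → Set
  OrbitMin i = ∀ t → toℕ i ≤ toℕ (iterate t i)

  orbitMin? : ∀ i → Dec (∀ (k : Fin m) → toℕ i ≤ toℕ (iterate (toℕ k) i))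
  orbitMin? i = all? λ k → toℕ i ≤? toℕ (iterate (toℕ k) i)

  orbitMin-bounded⇔ : Injective _≡_ _≡_ f → ∀ i → (∀ (k : Fin m) → toℕ i ≤ toℕ (iterate (toℕ k) i)) ⇔ OrbitMin i
  orbitMin-bounded⇔ f-inj i = mk⇔ to (λ min k → min (toℕ k))
    where
    to : (∀ (k : Fin m) → toℕ i ≤ toℕ (iterate (toℕ k) i)) → OrbitMin i
    to min t with orbit-bounded f-inj i t
    ... | k , fᵗi≡fᵏi = subst (λ y → toℕ i ≤ toℕ y) (sym fᵗi≡fᵏi) (min k)

iterate-cong : ∀ {m} {f g : Fin m → Fin m} → (∀ x → f x ≡ g x) → ∀ k x → iterate f k x ≡ iterate g k x
iterate-cong f≗g zero    x = refl
iterate-cong {f = f} f≗g (suc k) x = trans (cong f (iterate-cong f≗g k x)) (f≗g _)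

iverson-orbitMin? : ∀ {m n} {f : Fin m → Fin m} {g : Fin n → Fin n} → Injective _≡_ _≡_ f → Injective _≡_ _≡_ g →
                    ∀ {i j} → OrbitMin f i ⇔ OrbitMin g j → iverson (orbitMin? f i) ≡ iverson (orbitMin? g j)
iverson-orbitMin? f-inj g-inj {i} {j} i⇔j = iverson-cong
  (⇔.trans (orbitMin-bounded⇔ _ f-inj i)
     (⇔.trans i⇔j (⇔.sym (orbitMin-bounded⇔ _ g-inj j))))
  (orbitMin? _ i) (orbitMin? _ j)

excF : ∀ {n} → (Fin n → Fin n) → ℕ
excF f = Σℕ λ i → iverson (toℕ i <? toℕ (f i))

cycF : ∀ {n} → (Fin n → Fin n) → ℕ
cycF f = Σℕ λ i → iverson (orbitMin? f i)

module _ {n} {f g : Fin n → Fin n} (f≗g : ∀ x → f x ≡ g x) where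

  excF-cong : excF f ≡ excF g
  excF-cong = Σℕ-cong λ i → cong (λ y → iverson (toℕ i <? toℕ y)) (f≗g i)

  cycF-cong : cycF f ≡ cycF g
  cycF-cong = Σℕ-cong λ i → iverson-cong (mk⇔ (transport f≗g i) (transport (sym ∘ f≗g) i)) (orbitMin? f i) (orbitMin? g i)
    where
    transport : ∀ {f g} → (∀ x → f x ≡ g x) → ∀ i →
                (∀ (k : Fin n) → toℕ i ≤ toℕ (iterate f (toℕ k) i)) → ∀ (k : Fin n) → toℕ i ≤ toℕ (iterate g (toℕ k) i)
    transport f≗g i min k = subst (toℕ i ≤_) (cong toℕ (iterate-cong f≗g (toℕ k) i)) (min k)

module _ {n : ℕ} where

  transpose-matchˡ : ∀ (i j : Fin n) → PC.transpose i j i ≡ j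
  transpose-matchˡ i j rewrite dec-true (i ≟ i) refl = refl

  transpose-matchʳ : ∀ (i j : Fin n) → PC.transpose i j j ≡ i
  transpose-matchʳ i j with j ≟ i
  ... | yes j≡i = j≡i
  ... | no  _   rewrite dec-true (j ≟ j) refl = refl

  transpose-other : ∀ {i j k : Fin n} → k ≢ i → k ≢ j → PC.transpose i j k ≡ k
  transpose-other {i} {j} {k} k≢i k≢j rewrite dec-false (k ≟ i) k≢i | dec-false (k ≟ j) k≢j = refl

  transpose-involutive : ∀ (i j k : Fin n) → PC.transpose i j (PC.transpose i j k) ≡ k
  transpose-involutive i j k = by-cases (k ≟ i) (k ≟ j)
    where
    T = PC.transpose i j
    by-cases : Dec (k ≡ i) → Dec (k ≡ j) → T (T k) ≡ k
    by-cases (yes k≡i) _         = trans (cong (T ∘ T) k≡i) (trans (cong T (transpose-matchˡ i j)) (trans (transpose-matchʳ i j) (sym k≡i)))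
    by-cases (no k≢i)  (yes k≡j) = trans (cong (T ∘ T) k≡j) (trans (cong T (transpose-matchʳ i j)) (trans (transpose-matchˡ i j) (sym k≡j)))
    by-cases (no k≢i)  (no k≢j)  = trans (cong T (transpose-other k≢i k≢j)) (transpose-other k≢i k≢j)

  transpose-injective : ∀ (i j : Fin n) → Injective _≡_ _≡_ (PC.transpose i j)
  transpose-injective i j {x} {y} eq =
    trans (sym (transpose-involutive i j x)) (trans (cong (PC.transpose i j) eq) (transpose-involutive i j y))

module _ {n : ℕ} (f : Fin n → Fin n) where

  extend : Fin (suc n) → Fin (suc n)
  extend x with view x
  ... | ‵fromℕ      = fromℕ n
  ... | ‵inject₁ i  = inject₁ (f i)

  extend-fromℕ : extend (fromℕ n) ≡ fromℕ n
  extend-fromℕ rewrite view-fromℕ n = refl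

  extend-inject₁ : ∀ i → extend (inject₁ i) ≡ inject₁ (f i)
  extend-inject₁ i rewrite view-inject₁ i = refl

  extend-≡-fromℕ : ∀ x → extend x ≡ fromℕ n → x ≡ fromℕ n
  extend-≡-fromℕ x eq with view x
  ... | ‵fromℕ     = refl
  ... | ‵inject₁ i = contradiction (sym eq) Finₚ.fromℕ≢inject₁

  extend-injective : Injective _≡_ _≡_ f → Injective _≡_ _≡_ extend
  extend-injective f-inj {x} {y} eq with view x | view y
  ... | ‵fromℕ     | ‵fromℕ     = refl
  ... | ‵fromℕ     | ‵inject₁ j = contradiction eq Finₚ.fromℕ≢inject₁
  ... | ‵inject₁ i | ‵fromℕ     = contradiction (sym eq) Finₚ.fromℕ≢inject₁
  ... | ‵inject₁ i | ‵inject₁ j = cong inject₁ (f-inj (Finₚ.inject₁-injective eq))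

  -- insert j sends j to the new letter fromℕ n and the new letter to f j: the new letter is
  -- placed after j in its cycle, or becomes a fixed point when j = fromℕ n.
  insert : Fin (suc n) → Fin (suc n) → Fin (suc n)
  insert j = extend ∘ PC.transpose j (fromℕ n)

  insert-j : ∀ j → insert j j ≡ fromℕ n
  insert-j j = trans (cong extend (transpose-matchˡ j (fromℕ n))) extend-fromℕ

  insert-inject₁-fromℕ : ∀ j → insert (inject₁ j) (fromℕ n) ≡ inject₁ (f j)
  insert-inject₁-fromℕ j = trans (cong extend (transpose-matchʳ (inject₁ j) (fromℕ n))) (extend-inject₁ j)

  insert-inject₁ : ∀ {i} j → inject₁ i ≢ j → insert j (inject₁ i) ≡ inject₁ (f i)
  insert-inject₁ j i≢j =
    trans (cong extend (transpose-other i≢j (Finₚ.fromℕ≢inject₁ ∘ sym))) (extend-inject₁ _)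

  insert-≡-fromℕ : ∀ j x → insert j x ≡ fromℕ n → x ≡ j
  insert-≡-fromℕ j x eq = begin
    x                                    ≡⟨ transpose-involutive j (fromℕ n) x ⟨
    T (T x)                              ≡⟨ cong T (extend-≡-fromℕ (T x) eq) ⟩
    T (fromℕ n)                          ≡⟨ transpose-matchʳ j (fromℕ n) ⟩
    j                                    ∎
    where
    open ≡-Reasoning
    T = PC.transpose j (fromℕ n)

  insert-injective : Injective _≡_ _≡_ f → ∀ j → Injective _≡_ _≡_ (insert j)
  insert-injective f-inj j = transpose-injective j (fromℕ n) ∘ extend-injective f-inj

extend-cong : ∀ {n} {f g : Fin n → Fin n} → (∀ x → f x ≡ g x) → ∀ x → extend f x ≡ extend g x
extend-cong f≗g x with view x
... | ‵fromℕ     = refl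
... | ‵inject₁ i = cong inject₁ (f≗g i)

insert-cong : ∀ {n} {f g : Fin n → Fin n} → (∀ x → f x ≡ g x) → ∀ j x → insert f j x ≡ insert g j x
insert-cong f≗g j = extend-cong f≗g ∘ PC.transpose j (fromℕ _)

inject₁<fromℕ : ∀ {n} (i : Fin n) → toℕ (inject₁ i) < toℕ (fromℕ n)
inject₁<fromℕ {n} i = subst₂ _<_ (sym (Finₚ.toℕ-inject₁ i)) (sym (Finₚ.toℕ-fromℕ n)) (Finₚ.toℕ<n i)

excF-init : ∀ {n} (g : Fin (suc n) → Fin (suc n)) → excF g ≡ Σℕ λ i → iverson (toℕ (inject₁ i) <? toℕ (g (inject₁ i)))
excF-init {n} g = begin
  excF g                                      ≡⟨ Σℕ-init-last h ⟩
  Σℕ (h ∘ inject₁) ℕ.+ h (fromℕ n)            ≡⟨ cong (Σℕ (h ∘ inject₁) ℕ.+_) (iverson-no (ℕₚ.≤⇒≯ (Finₚ.≤fromℕ (g (fromℕ n)))) _) ⟩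
  Σℕ (h ∘ inject₁) ℕ.+ 0                      ≡⟨ ℕₚ.+-identityʳ _ ⟩
  Σℕ (h ∘ inject₁)                            ∎
  where
  open ≡-Reasoning
  h : Fin (suc n) → ℕ
  h x = iverson (toℕ x <? toℕ (g x))

excF-+-nonExc : ∀ {n} (f : Fin n → Fin n) → excF f ℕ.+ Σℕ (λ i → iverson (toℕ (f i) ≤? toℕ i)) ≡ n
excF-+-nonExc {n} f = begin
  excF f ℕ.+ Σℕ (λ i → iverson (toℕ (f i) ≤? toℕ i))                   ≡⟨ Σℕ-distrib-+ (λ i → iverson (toℕ i <? toℕ (f i))) _ ⟨
  Σℕ (λ i → iverson (toℕ i <? toℕ (f i)) ℕ.+ iverson (toℕ (f i) ≤? toℕ i)) ≡⟨ Σℕ-cong (λ i → iverson-<-+-≥ (toℕ i) (toℕ (f i))) ⟩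
  Σℕ {n} (λ _ → 1)                                                        ≡⟨ Σℕ-const-1 n ⟩
  n                                                                       ∎
  where open ≡-Reasoning

module _ {n : ℕ} (f : Fin n → Fin n) where

  private
    toℕ-insert-inject₁ : ∀ {i} j → inject₁ i ≢ j → toℕ (insert f j (inject₁ i)) ≡ toℕ (f i)
    toℕ-insert-inject₁ {i} j i≢j = trans (cong toℕ (insert-inject₁ f j i≢j)) (Finₚ.toℕ-inject₁ (f i))

  excF-insert-fromℕ : excF (insert f (fromℕ n)) ≡ excF f
  excF-insert-fromℕ = trans (excF-init (insert f (fromℕ n))) (Σℕ-cong λ i →
    cong₂ (λ a b → iverson (a <? b)) (Finₚ.toℕ-inject₁ i) (toℕ-insert-inject₁ (fromℕ n) (Finₚ.fromℕ≢inject₁ {i = i} ∘ sym)))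

  excF-insert-inject₁ : ∀ j → excF (insert f (inject₁ j)) ≡ excF f ℕ.+ iverson (toℕ (f j) ≤? toℕ j)
  excF-insert-inject₁ j = ℕₚ.+-cancelʳ-≡ _ _ _ (begin
    excF g ℕ.+ h j                      ≡⟨ cong (ℕ._+ h j) (excF-init g) ⟩
    Σℕ h′ ℕ.+ h j                       ≡⟨ Σℕ-update h h′ j h′≗h ⟩
    excF f ℕ.+ h′ j                     ≡⟨ cong (excF f ℕ.+_) (trans h′j≡1 (sym (iverson-<-+-≥ (toℕ j) (toℕ (f j))))) ⟩
    excF f ℕ.+ (h j ℕ.+ b)              ≡⟨ cong (excF f ℕ.+_) (ℕₚ.+-comm (h j) b) ⟩
    excF f ℕ.+ (b ℕ.+ h j)              ≡⟨ ℕₚ.+-assoc (excF f) b (h j) ⟨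
    excF f ℕ.+ b ℕ.+ h j                ∎)
    where
    open ≡-Reasoning
    g = insert f (inject₁ j)
    b = iverson (toℕ (f j) ≤? toℕ j)
    h h′ : Fin n → ℕ
    h i = iverson (toℕ i <? toℕ (f i))
    h′ i = iverson (toℕ (inject₁ i) <? toℕ (g (inject₁ i)))
    h′≗h : ∀ i → i ≢ j → h′ i ≡ h i
    h′≗h i i≢j = cong₂ (λ a b → iverson (a <? b)) (Finₚ.toℕ-inject₁ i)
                       (toℕ-insert-inject₁ (inject₁ j) (i≢j ∘ Finₚ.inject₁-injective))
    h′j≡1 : h′ j ≡ 1
    h′j≡1 = iverson-yes (subst (λ y → toℕ (inject₁ j) < toℕ y) (sym (insert-j f (inject₁ j))) (inject₁<fromℕ j)) _

  iterate-insert-fromℕ : ∀ t i → iterate (insert f (fromℕ n)) t (inject₁ i) ≡ inject₁ (iterate f t i)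
  iterate-insert-fromℕ zero    i = refl
  iterate-insert-fromℕ (suc t) i =
    trans (cong (insert f (fromℕ n)) (iterate-insert-fromℕ t i)) (insert-inject₁ f (fromℕ n) (Finₚ.fromℕ≢inject₁ ∘ sym))

  iterate-insert-fromℕ-fromℕ : ∀ t → iterate (insert f (fromℕ n)) t (fromℕ n) ≡ fromℕ n
  iterate-insert-fromℕ-fromℕ zero    = refl
  iterate-insert-fromℕ-fromℕ (suc t) = trans (cong (insert f (fromℕ n)) (iterate-insert-fromℕ-fromℕ t)) (insert-j f (fromℕ n))

  module _ (j i : Fin n) where

    private
      g = insert f (inject₁ j)
      g-step : ∀ {y} → y ≢ j → g (inject₁ y) ≡ inject₁ (f y)
      g-step y≢j = insert-inject₁ f (inject₁ j) (y≢j ∘ Finₚ.inject₁-injective)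

    -- The orbit of inject₁ i under g is that of i under f, with the new letter inserted after j.
    orbit-insert-inject₁⊆ : ∀ t → (∃ λ k → iterate g t (inject₁ i) ≡ inject₁ (iterate f k i))
                                  ⊎ (iterate g t (inject₁ i) ≡ fromℕ n × ∃ λ k → iterate f k i ≡ j)
    orbit-insert-inject₁⊆ zero = inj₁ (0 , refl)
    orbit-insert-inject₁⊆ (suc t) with orbit-insert-inject₁⊆ t
    ... | inj₂ (gᵗ≡L , k , fᵏ≡j) =
      inj₁ (suc k , trans (cong g gᵗ≡L) (trans (insert-inject₁-fromℕ f j) (cong (inject₁ ∘ f) (sym fᵏ≡j))))
    ... | inj₁ (k , gᵗ≡fᵏ) with iterate f k i ≟ j
    ...   | yes fᵏ≡j = inj₂ (trans (cong g (trans gᵗ≡fᵏ (cong inject₁ fᵏ≡j))) (insert-j f (inject₁ j)) , k , fᵏ≡j)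
    ...   | no  fᵏ≢j = inj₁ (suc k , trans (cong g gᵗ≡fᵏ) (g-step fᵏ≢j))

    orbit-insert-inject₁⊇ : ∀ k → ∃ λ t → iterate g t (inject₁ i) ≡ inject₁ (iterate f k i)
    orbit-insert-inject₁⊇ zero = 0 , refl
    orbit-insert-inject₁⊇ (suc k) with orbit-insert-inject₁⊇ k | iterate f k i ≟ j
    ... | t , gᵗ≡fᵏ | yes fᵏ≡j = suc (suc t) , (begin
      g (g (iterate g t (inject₁ i)))   ≡⟨ cong (g ∘ g) (trans gᵗ≡fᵏ (cong inject₁ fᵏ≡j)) ⟩
      g (g (inject₁ j))                 ≡⟨ cong g (insert-j f (inject₁ j)) ⟩
      g (fromℕ n)                       ≡⟨ insert-inject₁-fromℕ f j ⟩
      inject₁ (f j)                     ≡⟨ cong (inject₁ ∘ f) fᵏ≡j ⟨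
      inject₁ (f (iterate f k i))       ∎)
      where open ≡-Reasoning
    ... | t , gᵗ≡fᵏ | no  fᵏ≢j = suc t , trans (cong g gᵗ≡fᵏ) (g-step fᵏ≢j)

    orbitMin-insert-inject₁ : OrbitMin g (inject₁ i) ⇔ OrbitMin f i
    orbitMin-insert-inject₁ = mk⇔ to from
      where
      to : OrbitMin g (inject₁ i) → OrbitMin f i
      to min k with orbit-insert-inject₁⊇ k
      ... | t , gᵗ≡fᵏ = subst₂ _≤_ (Finₚ.toℕ-inject₁ i) (trans (cong toℕ gᵗ≡fᵏ) (Finₚ.toℕ-inject₁ _)) (min t)
      from : OrbitMin f i → OrbitMin g (inject₁ i)
      from min t with orbit-insert-inject₁⊆ t
      ... | inj₁ (k , gᵗ≡fᵏ) = subst₂ _≤_ (sym (Finₚ.toℕ-inject₁ i)) (sym (trans (cong toℕ gᵗ≡fᵏ) (Finₚ.toℕ-inject₁ _))) (min k)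
      ... | inj₂ (gᵗ≡L , _)  = subst (λ y → toℕ (inject₁ i) ≤ toℕ y) (sym gᵗ≡L) (ℕₚ.<⇒≤ (inject₁<fromℕ i))

  module _ (f-inj : Injective _≡_ _≡_ f) where

    cycF-insert-fromℕ : cycF (insert f (fromℕ n)) ≡ suc (cycF f)
    cycF-insert-fromℕ = begin
      cycF g                                                                   ≡⟨ Σℕ-init-last (iverson ∘ orbitMin? g) ⟩
      Σℕ (λ i → iverson (orbitMin? g (inject₁ i))) ℕ.+ iverson (orbitMin? g L)  ≡⟨ cong₂ ℕ._+_ (Σℕ-cong same-orbit) (iverson-yes L-min _) ⟩
      cycF f ℕ.+ 1                                                             ≡⟨ ℕₚ.+-comm (cycF f) 1 ⟩
      suc (cycF f)                                                             ∎
      where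
      open ≡-Reasoning
      L = fromℕ n
      g = insert f L
      same-orbit : ∀ i → iverson (orbitMin? g (inject₁ i)) ≡ iverson (orbitMin? f i)
      same-orbit i = iverson-orbitMin? (insert-injective f f-inj L) f-inj (mk⇔
        (λ min t → subst₂ _≤_ (Finₚ.toℕ-inject₁ i) (toℕ-orbit t) (min t))
        (λ min t → subst₂ _≤_ (sym (Finₚ.toℕ-inject₁ i)) (sym (toℕ-orbit t)) (min t)))
        where
        toℕ-orbit : ∀ t → toℕ (iterate g t (inject₁ i)) ≡ toℕ (iterate f t i)
        toℕ-orbit t = trans (cong toℕ (iterate-insert-fromℕ t i)) (Finₚ.toℕ-inject₁ _)
      L-min : ∀ (k : Fin (suc n)) → toℕ L ≤ toℕ (iterate g (toℕ k) L)
      L-min k = subst (λ y → toℕ L ≤ toℕ y) (sym (iterate-insert-fromℕ-fromℕ (toℕ k))) ℕₚ.≤-refl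

    cycF-insert-inject₁ : ∀ j → cycF (insert f (inject₁ j)) ≡ cycF f
    cycF-insert-inject₁ j = begin
      cycF g                                                                   ≡⟨ Σℕ-init-last (iverson ∘ orbitMin? g) ⟩
      Σℕ (λ i → iverson (orbitMin? g (inject₁ i))) ℕ.+ iverson (orbitMin? g L)  ≡⟨ cong₂ ℕ._+_ (Σℕ-cong same-orbit) (iverson-no L-not-min _) ⟩
      cycF f ℕ.+ 0                                                             ≡⟨ ℕₚ.+-identityʳ (cycF f) ⟩
      cycF f                                                                   ∎
      where
      open ≡-Reasoning
      L = fromℕ n
      g = insert f (inject₁ j)
      g-inj = insert-injective f f-inj (inject₁ j)
      same-orbit : ∀ i → iverson (orbitMin? g (inject₁ i)) ≡ iverson (orbitMin? f i)
      same-orbit i = iverson-orbitMin? g-inj f-inj (orbitMin-insert-inject₁ j i)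
      L-not-min : ¬ (∀ (k : Fin (suc n)) → toℕ L ≤ toℕ (iterate g (toℕ k) L))
      L-not-min min = ℕₚ.<⇒≱ (subst (λ y → toℕ y < toℕ L) (sym (insert-inject₁-fromℕ f j)) (inject₁<fromℕ (f j)))
                             (Equivalence.to (orbitMin-bounded⇔ g g-inj L) min 1)

concatMap-map≡cartesianProductWith : ∀ {A B C : Set} (f : A → B → C) xs ys →
  concatMap (λ x → map (f x) ys) xs ≡ cartesianProductWith f xs ys
concatMap-map≡cartesianProductWith f []       ys = refl
concatMap-map≡cartesianProductWith f (x ∷ xs) ys = cong (map (f x) ys ++_) (concatMap-map≡cartesianProductWith f xs ys)

module _ {A : Set} {xs : List A} where

  allVecs-unique : Unique xs → ∀ n → Unique (allVecs xs n)
  allVecs-unique xs! zero    = [] ∷ []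
  allVecs-unique xs! (suc n) = subst Unique (sym (concatMap-map≡cartesianProductWith Vec._∷_ xs (allVecs xs n)))
    (cartesianProductWith⁺ Vec._∷_ Vecₚ.∷-injective xs! (allVecs-unique xs! n))

  ∈-allVecs : (∀ x → x ∈ xs) → ∀ {n} (v : Vec A n) → v ∈ allVecs xs n
  ∈-allVecs ∈xs Vec.[]           = here refl
  ∈-allVecs ∈xs {suc n} (x Vec.∷ v) = subst (_ ∈_) (sym (concatMap-map≡cartesianProductWith Vec._∷_ xs (allVecs xs n)))
    (∈-cartesianProductWith⁺ Vec._∷_ (∈xs x) (∈-allVecs ∈xs v))

IsPerm⇒Injective : ∀ {n} {τ : Vec (Fin n) n} → IsPerm τ → Injective _≡_ _≡_ (lookup τ)
IsPerm⇒Injective τ-perm {i} {j} = τ-perm i j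

allPerms-unique : ∀ n → Unique (allPerms n)
allPerms-unique n = filter⁺ isPerm? (allVecs-unique (allFin⁺ n) n)

∈-allPerms⁺ : ∀ {n} {τ : Vec (Fin n) n} → IsPerm τ → τ ∈ allPerms n
∈-allPerms⁺ {τ = τ} = ∈-filter⁺ isPerm? (∈-allVecs ∈-allFin τ)

∈-allPerms⁻ : ∀ {n} {τ : Vec (Fin n) n} → τ ∈ allPerms n → IsPerm τ
∈-allPerms⁻ {n} = proj₂ ∘ ∈-filter⁻ isPerm? {xs = allVecs (allFin n) n}

lookup-extensionality : ∀ {A : Set} {n} {u v : Vec A n} → (∀ i → lookup u i ≡ lookup v i) → u ≡ v
lookup-extensionality {u = u} {v} u≗v =
  trans (sym (Vecₚ.tabulate∘lookup u)) (trans (Vecₚ.tabulate-cong u≗v) (Vecₚ.tabulate∘lookup v))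

insertVec : ∀ {n} → Vec (Fin n) n → Fin (suc n) → Vec (Fin (suc n)) (suc n)
insertVec τ j = tabulate (insert (lookup τ) j)

lookup-insertVec : ∀ {n} (τ : Vec (Fin n) n) j x → lookup (insertVec τ j) x ≡ insert (lookup τ) j x
lookup-insertVec τ j = Vecₚ.lookup∘tabulate (insert (lookup τ) j)

insertVec-IsPerm : ∀ {n} {τ : Vec (Fin n) n} → IsPerm τ → ∀ j → IsPerm (insertVec τ j)
insertVec-IsPerm {τ = τ} τ-perm j x y eq = insert-injective (lookup τ) (IsPerm⇒Injective {τ = τ} τ-perm) j
  (trans (sym (lookup-insertVec τ j x)) (trans eq (lookup-insertVec τ j y)))

insertVec-injective : ∀ {n} {τ τ′ : Vec (Fin n) n} {j j′} → insertVec τ j ≡ insertVec τ′ j′ → τ ≡ τ′ × j ≡ j′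
insertVec-injective {n} {τ} {τ′} {j} {j′} eq = τ≡τ′ , j≡j′
  where
  same : ∀ x → insert (lookup τ) j x ≡ insert (lookup τ′) j′ x
  same x = trans (sym (lookup-insertVec τ j x)) (trans (cong (λ v → lookup v x) eq) (lookup-insertVec τ′ j′ x))
  j≡j′ : j ≡ j′
  j≡j′ = insert-≡-fromℕ (lookup τ′) j′ j (trans (sym (same j)) (insert-j (lookup τ) j))
  T = PC.transpose j (fromℕ n)
  insert-T : ∀ (f : Fin n → Fin n) i → insert f j (T (inject₁ i)) ≡ inject₁ (f i)
  insert-T f i = trans (cong (extend f) (transpose-involutive j (fromℕ n) (inject₁ i))) (extend-inject₁ f i)
  τ≡τ′ : τ ≡ τ′
  τ≡τ′ = lookup-extensionality λ i → Finₚ.inject₁-injective (begin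
    inject₁ (lookup τ i)                ≡⟨ insert-T (lookup τ) i ⟨
    insert (lookup τ) j (T (inject₁ i))  ≡⟨ same (T (inject₁ i)) ⟩
    insert (lookup τ′) j′ (T (inject₁ i)) ≡⟨ cong (λ k → insert (lookup τ′) k (T (inject₁ i))) j≡j′ ⟨
    insert (lookup τ′) j (T (inject₁ i)) ≡⟨ insert-T (lookup τ′) i ⟩
    inject₁ (lookup τ′ i)               ∎)
    where open ≡-Reasoning

module _ {n : ℕ} {σ : Fin (suc n) → Fin (suc n)} (σ-inj : Injective _≡_ _≡_ σ) where

  preimage-fromℕ : ∃ λ j → σ j ≡ fromℕ n
  preimage-fromℕ with Finₚ.injective⇒existsPivot σ-inj (fromℕ n)
  ... | j , _ , n≤σj = j , Finₚ.toℕ-injective (ℕₚ.≤-antisym (Finₚ.≤fromℕ (σ j)) n≤σj)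

  insert-surjective : ∃₂ λ (f : Fin n → Fin n) j → Injective _≡_ _≡_ f × (∀ x → insert f j x ≡ σ x)
  insert-surjective = f , j , f-inj , insert-f≗σ
    where
    j = proj₁ preimage-fromℕ
    T = PC.transpose j (fromℕ n)
    h = σ ∘ T
    h-inj : Injective _≡_ _≡_ h
    h-inj = transpose-injective j (fromℕ n) ∘ σ-inj
    h-fromℕ : h (fromℕ n) ≡ fromℕ n
    h-fromℕ = trans (cong σ (transpose-matchʳ j (fromℕ n))) (proj₂ preimage-fromℕ)
    h-inject₁ : ∀ i → n ≢ toℕ (h (inject₁ i))
    h-inject₁ i n≡hi = Finₚ.fromℕ≢inject₁ {i = i} (sym (h-inj (trans hi≡L (sym h-fromℕ))))
      where hi≡L = Finₚ.toℕ-injective (trans (sym n≡hi) (sym (Finₚ.toℕ-fromℕ n)))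
    f : Fin n → Fin n
    f i = Fin.lower₁ (h (inject₁ i)) (h-inject₁ i)
    f-inj : Injective _≡_ _≡_ f
    f-inj = Finₚ.inject₁-injective ∘ h-inj ∘ Finₚ.lower₁-injective
    extend-f≗h : ∀ x → extend f x ≡ h x
    extend-f≗h x with view x
    ... | ‵fromℕ     = sym h-fromℕ
    ... | ‵inject₁ i = Finₚ.inject₁-lower₁ (h (inject₁ i)) (h-inject₁ i)
    insert-f≗σ : ∀ x → insert f j x ≡ σ x
    insert-f≗σ x = trans (extend-f≗h (T x)) (cong σ (transpose-involutive j (fromℕ n) x))

allPerms-suc-↭ : ∀ n → allPerms (suc n) ↭ cartesianProductWith insertVec (allPerms n) (allFin (suc n))
allPerms-suc-↭ n = ∼bag⇒↭ (unique∧set⇒bag (allPerms-unique (suc n)) insertions-unique (mk⇔ to from))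
  where
  insertions-unique : Unique (cartesianProductWith insertVec (allPerms n) (allFin (suc n)))
  insertions-unique = cartesianProductWith⁺ insertVec insertVec-injective (allPerms-unique n) (allFin⁺ (suc n))
  to : ∀ {σ} → σ ∈ allPerms (suc n) → σ ∈ cartesianProductWith insertVec (allPerms n) (allFin (suc n))
  to {σ} σ∈ with insert-surjective (IsPerm⇒Injective {τ = σ} (∈-allPerms⁻ σ∈))
  ... | f , j , f-inj , insert≗σ = subst (_∈ _) insertVec≡σ
    (∈-cartesianProductWith⁺ insertVec (∈-allPerms⁺ {τ = tabulate f} τ-perm) (∈-allFin j))
    where
    τ-perm : IsPerm (tabulate f)
    τ-perm a b eq = f-inj (trans (sym (Vecₚ.lookup∘tabulate f a)) (trans eq (Vecₚ.lookup∘tabulate f b)))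
    insertVec≡σ : insertVec (tabulate f) j ≡ σ
    insertVec≡σ = lookup-extensionality λ x → begin
      lookup (insertVec (tabulate f) j) x   ≡⟨ lookup-insertVec (tabulate f) j x ⟩
      insert (lookup (tabulate f)) j x      ≡⟨ insert-cong (Vecₚ.lookup∘tabulate f) j x ⟩
      insert f j x                          ≡⟨ insert≗σ x ⟩
      lookup σ x                            ∎
      where open ≡-Reasoning
  from : ∀ {σ} → σ ∈ cartesianProductWith insertVec (allPerms n) (allFin (suc n)) → σ ∈ allPerms (suc n)
  from σ∈ with ∈-cartesianProductWith⁻ insertVec (allPerms n) (allFin (suc n)) σ∈
  ... | τ , j , τ∈ , _ , refl = ∈-allPerms⁺ (insertVec-IsPerm {τ = τ} (∈-allPerms⁻ τ∈) j)

-- The signed excedance polynomial of S_n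

-- Summing the weights of the n + 1 ways to insert a new largest letter into a permutation of
-- weight M gives (n q - 1) M + (1 - q) θ M.
insertionOp : ℕ → Poly → Poly
insertionOp n M = (natP n *P qP +P constP (- + 1)) *P M +P negP (q-1 *P θ M)

insertionOp-[q-1]^ : ∀ m → insertionOp (suc m) (negP (q-1 ^P m)) ≋ negP (q-1 ^P suc m)
insertionOp-[q-1]^ m = begin
  insertionOp (suc m) (negP Y)
    ≈⟨ +P-congˡ (M *P negP Y) (scaleP-cong (- + 1) (*P-congˡ q-1 (θ-scaleP (- + 1) Y))) ⟩
  M *P negP Y +P negP (q-1 *P negP (θ Y))
    ≈⟨ solve 4 (λ n q y t → ((n ⊗ q ⊕ Κ minusOne) ⊗ (⊝ y) ⊕ (⊝ ((q ⊕ Κ minusOne) ⊗ (⊝ t))))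
                         ⊜ (⊝ ((q ⊕ Κ minusOne) ⊗ y) ⊕ ((q ⊕ Κ minusOne) ⊗ t ⊕ (⊝ ((n ⊕ Κ minusOne) ⊗ (q ⊗ y))))))
         ≋-refl (natP (suc m)) qP Y (θ Y) ⟩
  negP (q-1 *P Y) +P (q-1 *P θ Y +P negP (natP m *P (qP *P Y)))
    ≈⟨ +P-congˡ (negP (q-1 *P Y)) (≋-trans (+P-congʳ _ (θ-[q-1]^ m)) (+P-inverseʳ (natP m *P (qP *P Y)))) ⟩
  negP (q-1 *P Y) +P []
    ≈⟨ +P-identityʳ _ ⟩
  negP (q-1 ^P suc m) ∎
  where
  open ≋-Reasoning
  Y = q-1 ^P m
  M = natP (suc m) *P qP +P constP (- + 1)
  minusOne = constP (- + 1)

insertionOp-cong : ∀ n {p p′} → p ≋ p′ → insertionOp n p ≋ insertionOp n p′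
insertionOp-cong n {p} e = +P-cong (*P-congˡ (natP n *P qP +P constP (- + 1)) e) (scaleP-cong (- + 1) (*P-congˡ q-1 (θ-cong e)))

insertionOp-[] : ∀ n → insertionOp n [] ≋ []
insertionOp-[] n = +P-cong (*P-zeroʳ (natP n *P qP +P constP (- + 1))) (scaleP-cong (- + 1) (*P-zeroʳ q-1))

insertionOp-+P : ∀ n p s → insertionOp n (p +P s) ≋ insertionOp n p +P insertionOp n s
insertionOp-+P n p s = begin
  A *P (p +P s) +P negP (q-1 *P θ (p +P s))          ≈⟨ +P-congˡ (A *P (p +P s)) (scaleP-cong (- + 1) (*P-congˡ q-1 (θ-+P p s))) ⟩
  A *P (p +P s) +P negP (q-1 *P (θ p +P θ s))
    ≈⟨ solve 6 (λ A X p s t u → (A ⊗ (p ⊕ s) ⊕ (⊝ (X ⊗ (t ⊕ u)))) ⊜ ((A ⊗ p ⊕ (⊝ (X ⊗ t))) ⊕ (A ⊗ s ⊕ (⊝ (X ⊗ u)))))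
         ≋-refl A q-1 p s (θ p) (θ s) ⟩
  insertionOp n p +P insertionOp n s                  ∎
  where
  open ≋-Reasoning
  A = natP n *P qP +P constP (- + 1)

sgn : ℕ → ℤ
sgn c = (- + 1) ℤ.^ c

weight : ∀ {n} → Vec (Fin n) n → Poly
weight τ = monoP (sgn (cycF (lookup τ))) (excF (lookup τ))

PS : ℕ → Poly
PS n = sumP (map weight (allPerms n))

weight-insertVec : ∀ {n} (τ : Vec (Fin n) n) j →
                   weight (insertVec τ j) ≡ monoP (sgn (cycF (insert (lookup τ) j))) (excF (insert (lookup τ) j))
weight-insertVec τ j = cong₂ (λ c e → monoP (sgn c) e) (cycF-cong (lookup-insertVec τ j)) (excF-cong (lookup-insertVec τ j))

-- Since θ (q^e) = e q^e and n = e + B, this is the sum over the n + 1 insertion positions,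
-- B of which add an excedance.
insertionOp-monoP : ∀ {n} c e B → n ≡ e ℕ.+ B →
                    insertionOp n (monoP c e) ≋ monoP c e *P (natP n +P natP B *P q-1) +P negP (monoP c e)
insertionOp-monoP c e B refl = begin
  (natP (e ℕ.+ B) *P qP +P minusOne) *P M +P negP (q-1 *P θ M)
    ≈⟨ +P-congˡ ((natP (e ℕ.+ B) *P qP +P minusOne) *P M) (scaleP-cong (- + 1) (*P-congˡ q-1 (θ-monoP c e))) ⟩
  (natP (e ℕ.+ B) *P qP +P minusOne) *P M +P negP (q-1 *P (natP e *P M))
    ≈⟨ solve 4 (λ M E B q → (((E ⊕ B) ⊗ q ⊕ Κ minusOne) ⊗ M ⊕ (⊝ ((q ⊕ Κ minusOne) ⊗ (E ⊗ M))))
                          ⊜ (M ⊗ (E ⊕ B ⊕ B ⊗ (q ⊕ Κ minusOne)) ⊕ (⊝ M)))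
         ≋-refl M (natP e) (natP B) qP ⟩
  M *P (natP (e ℕ.+ B) +P natP B *P q-1) +P negP M ∎
  where
  open ≋-Reasoning
  M = monoP c e
  minusOne = constP (- + 1)

module _ {n} {τ : Vec (Fin n) n} (τ-perm : IsPerm τ) where

  private
    f = lookup τ
    f-inj = IsPerm⇒Injective {τ = τ} τ-perm

  weight-insertVec-fromℕ : weight (insertVec τ (fromℕ n)) ≋ negP (weight τ)
  weight-insertVec-fromℕ = ≋-trans
    (≡⇒≋ (trans (weight-insertVec τ (fromℕ n)) (cong₂ (λ c e → monoP (sgn c) e) (cycF-insert-fromℕ f f-inj) (excF-insert-fromℕ f))))
    (monoP-scaleP (- + 1) (sgn (cycF f)) (excF f))

  weight-insertVec-inject₁ : ∀ j → weight (insertVec τ (inject₁ j)) ≋ weight τ *P monoP (+ 1) (iverson (toℕ (f j) ≤? toℕ j))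
  weight-insertVec-inject₁ j = ≋-trans
    (≡⇒≋ (trans (weight-insertVec τ (inject₁ j)) (cong₂ (λ c e → monoP (sgn c) e) (cycF-insert-inject₁ f f-inj j) (excF-insert-inject₁ f j))))
    (monoP-+ (sgn (cycF f)) (excF f) (iverson (toℕ (f j) ≤? toℕ j)))

  sumP-weight-insertVec : sumP (map (weight ∘ insertVec τ) (allFin (suc n))) ≋ insertionOp n (weight τ)
  sumP-weight-insertVec = begin
    sumP (map (weight ∘ insertVec τ) (allFin (suc n)))                  ≡⟨ sumP-allFin (suc n) (weight ∘ insertVec τ) ⟩
    ΣP (weight ∘ insertVec τ)                                           ≈⟨ ΣP-init-last (weight ∘ insertVec τ) ⟩
    ΣP (weight ∘ insertVec τ ∘ inject₁) +P weight (insertVec τ (fromℕ n))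
      ≈⟨ +P-cong (ΣP-cong weight-insertVec-inject₁) weight-insertVec-fromℕ ⟩
    ΣP (λ j → weight τ *P monoP (+ 1) (b j)) +P negP (weight τ)
      ≈⟨ +P-congʳ (negP (weight τ)) (*P-distribˡ-ΣP (weight τ) (λ j → monoP (+ 1) (b j))) ⟨
    weight τ *P ΣP (λ j → monoP (+ 1) (b j)) +P negP (weight τ)
      ≈⟨ +P-congʳ (negP (weight τ)) (*P-congˡ (weight τ) (ΣP-monoP-iverson (λ j → toℕ (f j) ≤? toℕ j))) ⟩
    weight τ *P (natP n +P natP (Σℕ b) *P q-1) +P negP (weight τ)
      ≈⟨ insertionOp-monoP (sgn (cycF f)) (excF f) (Σℕ b) (sym (excF-+-nonExc f)) ⟨
    insertionOp n (weight τ)                                            ∎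
    where
    open ≋-Reasoning
    b : Fin n → ℕ
    b j = iverson (toℕ (f j) ≤? toℕ j)

PS-suc : ∀ n → PS (suc n) ≋ insertionOp n (PS n)
PS-suc n = begin
  sumP (map weight (allPerms (suc n)))
    ≈⟨ sumP-↭ weight (allPerms-suc-↭ n) ⟩
  sumP (map weight (cartesianProductWith insertVec (allPerms n) (allFin (suc n))))
    ≈⟨ sumP-cartesianProductWith weight insertVec (allPerms n) (allFin (suc n)) ⟩
  sumP (map (λ τ → sumP (map (weight ∘ insertVec τ) (allFin (suc n)))) (allPerms n))
    ≈⟨ sumP-cong (allPerms n) (λ {τ} τ∈ → sumP-weight-insertVec {τ = τ} (∈-allPerms⁻ τ∈)) ⟩
  sumP (map (insertionOp n ∘ weight) (allPerms n))
    ≈⟨ sumP-homo (insertionOp n) (insertionOp-[] n) (insertionOp-+P n) weight (allPerms n) ⟨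
  insertionOp n (PS n) ∎
  where open ≋-Reasoning

PS-closed : ∀ m → PS (suc m) ≋ negP (q-1 ^P m)
PS-closed zero    = ≋-refl
PS-closed (suc m) = ≋-trans (PS-suc (suc m)) (≋-trans (insertionOp-cong (suc m) (PS-closed m)) (insertionOp-[q-1]^ m))

-- Coloured permutations

[_]q : ℕ → Poly
[ r ]q = ΣP λ (a : Fin r) → monoP (+ 1) (toℕ a)

ΣP-monoP-suc : ∀ r → ΣP (λ (a : Fin r) → monoP (+ 1) (suc (toℕ a))) ≋ qP *P [ r ]q
ΣP-monoP-suc r = begin
  ΣP {r} (λ a → monoP (+ 1) (suc (toℕ a)))  ≈⟨ ΣP-cong {r} (λ a → qP-*P (monoP (+ 1) (toℕ a))) ⟨
  ΣP {r} (λ a → qP *P monoP (+ 1) (toℕ a))  ≈⟨ *P-distribˡ-ΣP {r} qP (λ a → monoP (+ 1) (toℕ a)) ⟨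
  qP *P [ r ]q                             ∎
  where open ≋-Reasoning

[r]q*[q-1] : ∀ r → [ r ]q *P q-1 ≋ qP ^P r +P constP (- + 1)
[r]q*[q-1] zero    = ≋-sym (0∷-[] ≋-refl)
[r]q*[q-1] (suc r) = begin
  (constP (+ 1) +P ΣP {r} (λ a → monoP (+ 1) (suc (toℕ a)))) *P q-1   ≈⟨ *P-congʳ q-1 (+P-congˡ (constP (+ 1)) (ΣP-monoP-suc r)) ⟩
  (constP (+ 1) +P qP *P [ r ]q) *P q-1
    ≈⟨ solve 2 (λ q R → ((Κ (constP (+ 1)) ⊕ q ⊗ R) ⊗ (q ⊕ Κ minusOne)) ⊜ ((q ⊕ Κ minusOne) ⊕ q ⊗ (R ⊗ (q ⊕ Κ minusOne)))) ≋-refl qP [ r ]q ⟩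
  q-1 +P qP *P ([ r ]q *P q-1)                                     ≈⟨ +P-congˡ q-1 (*P-congˡ qP ([r]q*[q-1] r)) ⟩
  q-1 +P qP *P (qP ^P r +P minusOne)
    ≈⟨ solve 2 (λ q Y → ((q ⊕ Κ minusOne) ⊕ q ⊗ (Y ⊕ Κ minusOne)) ⊜ (q ⊗ Y ⊕ Κ minusOne)) ≋-refl qP (qP ^P r) ⟩
  qP ^P suc r +P minusOne                                          ∎
  where
  open ≋-Reasoning
  minusOne = constP (- + 1)

q^[1+r]+ΣP≋qP*[1+r]q : ∀ r → monoP (+ 1) (suc r) +P ΣP {r} (λ b → monoP (+ 1) (suc (toℕ b))) ≋ qP *P [ suc r ]q
q^[1+r]+ΣP≋qP*[1+r]q r = begin
  monoP (+ 1) (suc r) +P ΣP {r} (λ b → monoP (+ 1) (suc (toℕ b)))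
    ≈⟨ +P-comm (monoP (+ 1) (suc r)) _ ⟩
  ΣP {r} (λ b → monoP (+ 1) (suc (toℕ b))) +P monoP (+ 1) (suc r)
    ≈⟨ +P-cong (ΣP-cong {r} (≡⇒≋ ∘ cong (monoP (+ 1) ∘ suc) ∘ sym ∘ Finₚ.toℕ-inject₁))
               (≡⇒≋ (cong (monoP (+ 1) ∘ suc) (sym (Finₚ.toℕ-fromℕ r)))) ⟩
  ΣP {r} (λ b → monoP (+ 1) (suc (toℕ (inject₁ b)))) +P monoP (+ 1) (suc (toℕ (fromℕ r)))
    ≈⟨ ΣP-init-last (λ a → monoP (+ 1) (suc (toℕ a))) ⟨
  ΣP {suc r} (λ a → monoP (+ 1) (suc (toℕ a)))
    ≈⟨ ΣP-monoP-suc (suc r) ⟩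
  qP *P [ suc r ]q ∎
  where open ≋-Reasoning

module _ {r n : ℕ} (z : Vec (Fin r) n) (τ : Vec (Fin n) n) where

  iter≡iterate : ∀ k i → iter (z , τ) k i ≡ iterate (lookup τ) k i
  iter≡iterate zero    i = refl
  iter≡iterate (suc k) i = cong (lookup τ) (iter≡iterate k i)

  cyc≡cycF : cyc (z , τ) ≡ cycF (lookup τ)
  cyc≡cycF = trans (countFin≡Σℕ n _) (Σℕ-cong λ i → iverson-cong
    (mk⇔ (λ min k → subst (toℕ i ≤_) (cong toℕ (iter≡iterate (toℕ k) i)) (min k))
         (λ min k → subst (toℕ i ≤_) (cong toℕ (sym (iter≡iterate (toℕ k) i))) (min k))) _ _)

  sign≡sgn : (+ 1) ℤ.^ fix (z , τ) ℤ.* (- + 1) ℤ.^ cyc (z , τ) ≡ sgn (cycF (lookup τ))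
  sign≡sgn = trans (cong (ℤ._* (- + 1) ℤ.^ cyc (z , τ)) (ℤₚ.^-zeroˡ (fix (z , τ)))) (trans (ℤₚ.*-identityˡ _) (cong sgn cyc≡cycF))

excLetter : Order → ∀ {n} r → Vec (Fin n) n → Fin n → Fin r → ℕ
excLetter Abs     r τ i a = iverson (toℕ i <? toℕ (lookup τ i)) ℕ.+ toℕ a
excLetter Clr {n} r τ i a =
  r ℕ.* iverson ((suc (toℕ i) ≤? n ∸ 1) ×-dec (toℕ a ℕ.≟ 0) ×-dec (toℕ i <? toℕ (lookup τ i))) ℕ.+ toℕ a

excO≡Σℕ : ∀ O {r n} (z : Vec (Fin r) n) τ → excO O (z , τ) ≡ Σℕ (λ i → excLetter O r τ i (lookup z i))
excO≡Σℕ Abs {r} {n} z τ = begin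
  exc (z , τ) ℕ.+ csum (z , τ)                              ≡⟨ cong₂ ℕ._+_ (countFin≡Σℕ n _) (sum-allFin n _) ⟩
  excF (lookup τ) ℕ.+ Σℕ (λ i → toℕ (lookup z i))           ≡⟨ Σℕ-distrib-+ (λ i → iverson (toℕ i <? toℕ (lookup τ i))) (λ i → toℕ (lookup z i)) ⟨
  Σℕ (λ i → excLetter Abs r τ i (lookup z i))               ∎
  where open ≡-Reasoning
excO≡Σℕ Clr {r} {n} z τ = begin
  r ℕ.* excA (z , τ) ℕ.+ csum (z , τ)                        ≡⟨ cong₂ (λ x y → r ℕ.* x ℕ.+ y) (countFin≡Σℕ n _) (sum-allFin n _) ⟩
  r ℕ.* Σℕ excAᵢ ℕ.+ Σℕ (λ i → toℕ (lookup z i))            ≡⟨ cong (ℕ._+ _) (*-distribˡ-Σℕ r excAᵢ) ⟩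
  Σℕ (λ i → r ℕ.* excAᵢ i) ℕ.+ Σℕ (λ i → toℕ (lookup z i))  ≡⟨ Σℕ-distrib-+ (λ i → r ℕ.* excAᵢ i) (λ i → toℕ (lookup z i)) ⟨
  Σℕ (λ i → excLetter Clr r τ i (lookup z i))               ∎
  where
  open ≡-Reasoning
  excAᵢ : Fin n → ℕ
  excAᵢ i = iverson ((suc (toℕ i) ≤? n ∸ 1) ×-dec (toℕ (lookup z i) ℕ.≟ 0) ×-dec (toℕ i <? toℕ (lookup τ i)))

sumP-excLetter : ∀ O {n} r → 1 ≤ r → (τ : Vec (Fin n) n) (i : Fin n) →
  sumP (map (monoP (+ 1) ∘ excLetter O r τ i) (allFin r)) ≋ monoP (+ 1) (iverson (toℕ i <? toℕ (lookup τ i))) *P [ r ]q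
sumP-excLetter Abs r _ τ i = begin
  sumP (map (λ a → monoP (+ 1) (e ℕ.+ toℕ a)) (allFin r))              ≈⟨ sumP-cong′ (allFin r) (λ a → monoP-+ (+ 1) e (toℕ a)) ⟩
  sumP (map (λ a → monoP (+ 1) e *P monoP (+ 1) (toℕ a)) (allFin r))   ≈⟨ *P-distribˡ-sumP (monoP (+ 1) e) (monoP (+ 1) ∘ toℕ) (allFin r) ⟨
  monoP (+ 1) e *P sumP (map (monoP (+ 1) ∘ toℕ) (allFin r))           ≡⟨ cong (monoP (+ 1) e *P_) (sumP-allFin r (monoP (+ 1) ∘ toℕ)) ⟩
  monoP (+ 1) e *P [ r ]q                                              ∎
  where
  open ≋-Reasoning
  e = iverson (toℕ i <? toℕ (lookup τ i))
sumP-excLetter Clr {suc n} (suc r) _ τ i = by-cases (toℕ i <? toℕ (lookup τ i))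
  where
  open ≋-Reasoning
  by-cases : (d : Dec (toℕ i < toℕ (lookup τ i))) →
    sumP (map (monoP (+ 1) ∘ excLetter Clr (suc r) τ i) (allFin (suc r))) ≋ monoP (+ 1) (iverson d) *P [ suc r ]q
  by-cases (no i≮τi) = begin
    sumP (map (monoP (+ 1) ∘ excLetter Clr (suc r) τ i) (allFin (suc r)))  ≈⟨ sumP-cong′ (allFin (suc r)) (≡⇒≋ ∘ cong (monoP (+ 1)) ∘ W≡a) ⟩
    sumP (map (monoP (+ 1) ∘ toℕ) (allFin (suc r)))                         ≡⟨ sumP-allFin (suc r) (monoP (+ 1) ∘ toℕ) ⟩
    [ suc r ]q                                                              ≈⟨ *P-identityˡ [ suc r ]q ⟨
    monoP (+ 1) 0 *P [ suc r ]q                                             ∎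
    where
    W≡a : ∀ a → excLetter Clr (suc r) τ i a ≡ toℕ a
    W≡a a = trans (cong (λ x → suc r ℕ.* x ℕ.+ toℕ a) (iverson-no (i≮τi ∘ proj₂ ∘ proj₂) _))
                  (cong (ℕ._+ toℕ a) (ℕₚ.*-zeroʳ (suc r)))
  by-cases (yes i<τi) = begin
    sumP (map (monoP (+ 1) ∘ W) (allFin (suc r)))
      ≡⟨ sumP-allFin (suc r) (monoP (+ 1) ∘ W) ⟩
    monoP (+ 1) (W Fin.zero) +P ΣP (monoP (+ 1) ∘ W ∘ Fin.suc)
      ≈⟨ +P-cong (≡⇒≋ (cong (monoP (+ 1)) W₀≡r)) (ΣP-cong (≡⇒≋ ∘ cong (monoP (+ 1)) ∘ W-suc)) ⟩
    monoP (+ 1) (suc r) +P ΣP {r} (λ b → monoP (+ 1) (suc (toℕ b)))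
      ≈⟨ q^[1+r]+ΣP≋qP*[1+r]q r ⟩
    qP *P [ suc r ]q ∎
    where
    W = excLetter Clr (suc r) τ i
    W₀≡r : W Fin.zero ≡ suc r
    W₀≡r = trans (cong (λ x → suc r ℕ.* x ℕ.+ 0) (iverson-yes (i+1≤n , refl , i<τi) _))
                 (trans (ℕₚ.+-identityʳ (suc r ℕ.* 1)) (ℕₚ.*-identityʳ (suc r)))
      where
      i+1≤n : suc (toℕ i) ≤ n
      i+1≤n = ℕₚ.≤-trans i<τi (ℕ.s≤s⁻¹ (Finₚ.toℕ<n (lookup τ i)))
    W-suc : ∀ b → W (Fin.suc b) ≡ suc (toℕ b)
    W-suc b = cong (ℕ._+ suc (toℕ b)) (trans (cong (suc r ℕ.*_) (iverson-no (ℕₚ.1+n≢0 ∘ proj₁ ∘ proj₂) _)) (ℕₚ.*-zeroʳ (suc r)))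

-- Σ_{z ∈ Aⁿ} q^{Σᵢ Wᵢ(zᵢ)} factorises as Πᵢ Σ_{a ∈ A} q^{Wᵢ(a)}.
sumP-allVecs : ∀ {A : Set} (xs : List A) R n (W : Fin n → A → ℕ) (e : Fin n → ℕ) →
  (∀ i → sumP (map (monoP (+ 1) ∘ W i) xs) ≋ monoP (+ 1) (e i) *P R) →
  sumP (map (λ z → monoP (+ 1) (Σℕ λ i → W i (lookup z i))) (allVecs xs n)) ≋ monoP (+ 1) (Σℕ e) *P R ^P n
sumP-allVecs xs R zero    W e factor = ≋-sym (*P-identityʳ (constP (+ 1)))
sumP-allVecs xs R (suc n) W e factor = begin
  sumP (map F (concatMap (λ a → map (a Vec.∷_) (allVecs xs n)) xs))
    ≡⟨ cong (sumP ∘ map F) (concatMap-map≡cartesianProductWith Vec._∷_ xs (allVecs xs n)) ⟩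
  sumP (map F (cartesianProductWith Vec._∷_ xs (allVecs xs n)))
    ≈⟨ sumP-cartesianProductWith F Vec._∷_ xs (allVecs xs n) ⟩
  sumP (map (λ a → sumP (map (λ z → monoP (+ 1) (W₀ a ℕ.+ S z)) (allVecs xs n))) xs)
    ≈⟨ sumP-cong′ xs (λ a → sumP-cong′ (allVecs xs n) (λ z → monoP-+ (+ 1) (W₀ a) (S z))) ⟩
  sumP (map (λ a → sumP (map (λ z → monoP (+ 1) (W₀ a) *P monoP (+ 1) (S z)) (allVecs xs n))) xs)
    ≈⟨ sumP-cong′ xs (λ a → *P-distribˡ-sumP (monoP (+ 1) (W₀ a)) (monoP (+ 1) ∘ S) (allVecs xs n)) ⟨
  sumP (map (λ a → monoP (+ 1) (W₀ a) *P sumP (map (monoP (+ 1) ∘ S) (allVecs xs n))) xs)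
    ≈⟨ *P-distribʳ-sumP (sumP (map (monoP (+ 1) ∘ S) (allVecs xs n))) (monoP (+ 1) ∘ W₀) xs ⟨
  sumP (map (monoP (+ 1) ∘ W₀) xs) *P sumP (map (monoP (+ 1) ∘ S) (allVecs xs n))
    ≈⟨ *P-cong (factor Fin.zero) (sumP-allVecs xs R n (W ∘ Fin.suc) (e ∘ Fin.suc) (factor ∘ Fin.suc)) ⟩
  (monoP (+ 1) (e Fin.zero) *P R) *P (monoP (+ 1) (Σℕ (e ∘ Fin.suc)) *P R ^P n)
    ≈⟨ solve 4 (λ a r b p → ((a ⊗ r) ⊗ (b ⊗ p)) ⊜ ((a ⊗ b) ⊗ (r ⊗ p))) ≋-refl
         (monoP (+ 1) (e Fin.zero)) R (monoP (+ 1) (Σℕ (e ∘ Fin.suc))) (R ^P n) ⟩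
  (monoP (+ 1) (e Fin.zero) *P monoP (+ 1) (Σℕ (e ∘ Fin.suc))) *P R ^P suc n
    ≈⟨ *P-congʳ (R ^P suc n) (monoP-+ (+ 1) (e Fin.zero) (Σℕ (e ∘ Fin.suc))) ⟨
  monoP (+ 1) (Σℕ e) *P R ^P suc n ∎
  where
  open ≋-Reasoning
  F : Vec _ (suc n) → Poly
  F z = monoP (+ 1) (Σℕ λ i → W i (lookup z i))
  W₀ = W Fin.zero
  S : Vec _ n → ℕ
  S z = Σℕ λ i → W (Fin.suc i) (lookup z i)

sumP-colourings : ∀ O r → 1 ≤ r → ∀ {n} (τ : Vec (Fin n) n) →
  sumP (map (λ z → monoP ((+ 1) ℤ.^ fix (z , τ) ℤ.* (- + 1) ℤ.^ cyc (z , τ)) (excO O (z , τ))) (allVecs (allFin r) n))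
    ≋ weight τ *P [ r ]q ^P n
sumP-colourings O r 1≤r {n} τ = begin
  sumP (map (λ z → monoP (sign z) (excO O (z , τ))) Zs)
    ≈⟨ sumP-cong′ Zs (λ z → ≡⇒≋ (cong₂ monoP (trans (sign≡sgn z τ) (sym (ℤₚ.*-identityʳ s))) (excO≡Σℕ O z τ))) ⟩
  sumP (map (λ z → monoP (s ℤ.* + 1) (Σℕ λ i → W i (lookup z i))) Zs)
    ≈⟨ sumP-cong′ Zs (λ z → monoP-scaleP s (+ 1) _) ⟩
  sumP (map (λ z → scaleP s (monoP (+ 1) (Σℕ λ i → W i (lookup z i)))) Zs)
    ≈⟨ sumP-homo (scaleP s) ≋-refl (scaleP-distribˡ s) (λ z → monoP (+ 1) (Σℕ λ i → W i (lookup z i))) Zs ⟨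
  scaleP s (sumP (map (λ z → monoP (+ 1) (Σℕ λ i → W i (lookup z i))) Zs))
    ≈⟨ scaleP-cong s (sumP-allVecs (allFin r) [ r ]q n W (λ i → iverson (toℕ i <? toℕ (lookup τ i))) (sumP-excLetter O r 1≤r τ)) ⟩
  scaleP s (monoP (+ 1) (excF (lookup τ)) *P [ r ]q ^P n)
    ≈⟨ scaleP-*P s (monoP (+ 1) (excF (lookup τ))) ([ r ]q ^P n) ⟩
  scaleP s (monoP (+ 1) (excF (lookup τ))) *P [ r ]q ^P n
    ≈⟨ *P-congʳ ([ r ]q ^P n) (≋-trans (≡⇒≋ (cong (λ c → monoP c (excF (lookup τ))) (sym (ℤₚ.*-identityʳ s)))) (monoP-scaleP s (+ 1) _)) ⟨
  weight τ *P [ r ]q ^P n ∎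
  where
  open ≋-Reasoning
  Zs = allVecs (allFin r) n
  sign : Vec (Fin r) n → ℤ
  sign z = (+ 1) ℤ.^ fix (z , τ) ℤ.* (- + 1) ℤ.^ cyc (z , τ)
  s = sgn (cycF (lookup τ))
  W = excLetter O r τ

PG≋PS*[r]q^ : ∀ O r n → 1 ≤ r → PG O r n ≋ PS n *P [ r ]q ^P n
PG≋PS*[r]q^ O r n 1≤r = begin
  sumP (map F (concatMap (λ z → map (z ,_) (allPerms n)) Zs))
    ≡⟨ cong (sumP ∘ map F) (concatMap-map≡cartesianProductWith _,_ Zs (allPerms n)) ⟩
  sumP (map F (cartesianProductWith _,_ Zs (allPerms n)))
    ≈⟨ sumP-cartesianProductWith F _,_ Zs (allPerms n) ⟩
  sumP (map (λ z → sumP (map (λ τ → F (z , τ)) (allPerms n))) Zs)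
    ≈⟨ sumP-comm (λ z τ → F (z , τ)) Zs (allPerms n) ⟩
  sumP (map (λ τ → sumP (map (λ z → F (z , τ)) Zs)) (allPerms n))
    ≈⟨ sumP-cong′ (allPerms n) (sumP-colourings O r 1≤r) ⟩
  sumP (map (λ τ → weight τ *P [ r ]q ^P n) (allPerms n))
    ≈⟨ *P-distribʳ-sumP ([ r ]q ^P n) weight (allPerms n) ⟨
  PS n *P [ r ]q ^P n ∎
  where
  open ≋-Reasoning
  Zs = allVecs (allFin r) n
  F : G r n → Poly
  F σ = monoP ((+ 1) ℤ.^ fix σ ℤ.* (- + 1) ℤ.^ cyc σ) (excO O σ)

PG-closed : ∀ O r m → 1 ≤ r → PG O r (suc m) ≋ negP (q-1 ^P m) *P [ r ]q ^P suc m
PG-closed O r m 1≤r = ≋-trans (PG≋PS*[r]q^ O r (suc m) 1≤r) (*P-congʳ ([ r ]q ^P suc m) (PS-closed m))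

PG-Abs≋Clr : ∀ r n → 1 ≤ r → PG Abs r n ≋ PG Clr r n
PG-Abs≋Clr r n 1≤r = ≋-trans (PG≋PS*[r]q^ Abs r n 1≤r) (≋-sym (PG≋PS*[r]q^ Clr r n 1≤r))

PG-suc : ∀ O r m → 1 ≤ r → PG O r (suc (suc m)) ≋ (qP ^P r +P constP (- + 1)) *P PG O r (suc m)
PG-suc O r m 1≤r = begin
  PG O r (suc (suc m))                               ≈⟨ PG-closed O r (suc m) 1≤r ⟩
  negP (q-1 *P q-1 ^P m) *P ([ r ]q *P [ r ]q ^P suc m)
    ≈⟨ solve 4 (λ X Y R Z → ((⊝ (X ⊗ Y)) ⊗ (R ⊗ Z)) ⊜ ((R ⊗ X) ⊗ ((⊝ Y) ⊗ Z))) ≋-refl q-1 (q-1 ^P m) [ r ]q ([ r ]q ^P suc m) ⟩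
  ([ r ]q *P q-1) *P (negP (q-1 ^P m) *P [ r ]q ^P suc m)   ≈⟨ *P-cong ([r]q*[q-1] r) (≋-sym (PG-closed O r m 1≤r)) ⟩
  (qP ^P r +P constP (- + 1)) *P PG O r (suc m)      ∎
  where open ≋-Reasoning

q-1*PG-closed : ∀ O r m → 1 ≤ r → q-1 *P PG O r (suc m) ≋ negP ((qP ^P r +P constP (- + 1)) ^P suc m)
q-1*PG-closed O r m 1≤r = begin
  q-1 *P PG O r (suc m)                            ≈⟨ *P-congˡ q-1 (PG-closed O r m 1≤r) ⟩
  q-1 *P (negP (q-1 ^P m) *P R ^P suc m)
    ≈⟨ solve 3 (λ X Y Z → (X ⊗ ((⊝ Y) ⊗ Z)) ⊜ (⊝ (Z ⊗ (X ⊗ Y)))) ≋-refl q-1 (q-1 ^P m) (R ^P suc m) ⟩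
  negP (R ^P suc m *P q-1 ^P suc m)                ≈⟨ scaleP-cong (- + 1) (^P-distrib-*P R q-1 (suc m)) ⟨
  negP ((R *P q-1) ^P suc m)                       ≈⟨ scaleP-cong (- + 1) (^P-congˡ (suc m) ([r]q*[q-1] r)) ⟩
  negP ((qP ^P r +P constP (- + 1)) ^P suc m)      ∎
  where
  open ≋-Reasoning
  R = [ r ]q

theorem1 : (r : ℕ) → 1 ≤ r →
    ((n : ℕ) → 2 ≤ n → (O : Order) →
       PG O r n ≈P (qP ^P r +P constP (- + 1)) *P PG O r (n ∸ 1))
    × ((n : ℕ) → 2 ≤ n → PG Abs r n ≈P PG Clr r n)
    × ((n : ℕ) → 1 ≤ n →
       (PG Abs r n ≈P PG Clr r n)
       × ((qP +P constP (- + 1)) *P PG Abs r n ≈P negP ((qP ^P r +P constP (- + 1)) ^P n))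
       × ((qP +P constP (- + 1)) *P PG Clr r n ≈P negP ((qP ^P r +P constP (- + 1)) ^P n)))
theorem1 r 1≤r = recursion , (λ n _ → coeff-≡ (PG-Abs≋Clr r n 1≤r)) , closed-forms
  where
  recursion : (n : ℕ) → 2 ≤ n → (O : Order) → PG O r n ≈P (qP ^P r +P constP (- + 1)) *P PG O r (n ∸ 1)
  recursion (suc (suc m)) (ℕ.s≤s (ℕ.s≤s ℕ.z≤n)) O = coeff-≡ (PG-suc O r m 1≤r)
  closed-forms : (n : ℕ) → 1 ≤ n →
       (PG Abs r n ≈P PG Clr r n)
       × ((qP +P constP (- + 1)) *P PG Abs r n ≈P negP ((qP ^P r +P constP (- + 1)) ^P n))
       × ((qP +P constP (- + 1)) *P PG Clr r n ≈P negP ((qP ^P r +P constP (- + 1)) ^P n))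
  closed-forms (suc m) _ =
    coeff-≡ (PG-Abs≋Clr r (suc m) 1≤r) , coeff-≡ (q-1*PG-closed Abs r m 1≤r) , coeff-≡ (q-1*PG-closed Clr r m 1≤r)
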